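{- Let $\mathcal{P}$ be a projective plane of order $n\ge 5$ and let $A,B,C$ be three non-collinear points of $\mathcal{P}$. Delete from $\mathcal{P}$ all points lying on the lines $AB$, $AC$, $BC$ and all lines passing through $A$, $B$ or $C$. The remaining points and lines (with the induced incidence) form a strongly regular configuration with parameters $(v_k;\lambda,\mu)$ where $v=(n-1)^2$, $k=n-2$, $\lambda=(n-4)^2+1$, $\mu=(n-3)(n-4)$. Moreover, this configuration is not an $(\alpha,\beta)$-geometry.
   Context: A symmetric $(v_k)$ configuration is a finite incidence structure of $v$ points and $v$ lines such that every line has exactly $k$ points, every point lies on exactly $k$ lines, and two distinct points lie on at most one common line. Its point graph has the points as vertices, two distinct points adjacent iff they lie on a common line. A strongly regular configuration with parameters $(v_k;\lambda,\mu)$ is a symmetric $(v_k)$ configuration whose point graph is a strongly regular graph $SRG(v,k(k-1),\lambda,\mu)$. An $(\alpha,\beta)$-geometry is a configuration for which there are constants $\alpha,\beta$ such that for every non-incident point–line pair $(P,\ell)$, the number of points on $\ell$ collinear with $P$ is either $\alpha$ or $\beta$. -}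

module Defs where

open import Data.Nat using (ℕ; suc; _*_; _∸_)
open import Data.Product using (Σ; ∃; ∃-syntax; _×_; _,_)
open import Data.Sum using (_⊎_)
open import Data.Unit using (⊤)
open import Data.List using (List; length)
open import Data.List.Relation.Unary.All using (All)
open import Data.List.Relation.Unary.Unique.Propositional using (Unique)
open import Data.List.Membership.Propositional using (_∈_)
open import Data.Refinement using (Refinement; _,_; value)
open import Relation.Nullary using (¬_)
open import Relation.Binary.PropositionalEquality using (_≡_; _≢_)

-- Finite cardinality of a predicate on a type.
-- "P has exactly n elements": there is a duplicate-free list of length n
-- consisting of elements satisfying P and containing every element
-- satisfying P.  (Insensitive to proof relevance of P.)

HasCard : {A : Set} → (A → Set) → ℕ → Set
HasCard {A} P n =
  Σ (List A) λ xs → length xs ≡ n × Unique xs × All P xs × (∀ x → P x → x ∈ xs)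

HasSize : Set → ℕ → Set
HasSize A n = HasCard {A} (λ _ → ⊤) n

record IncStr : Set₁ where
  field
    Point : Set
    Line  : Set
    _I_   : Point → Line → Set

module _ (S : IncStr) where
  open IncStr S

  Collinear : Point → Point → Set
  Collinear P Q = ∃[ ℓ ] (P I ℓ × Q I ℓ)

  Collinear₃ : Point → Point → Point → Set
  Collinear₃ P Q R = ∃[ ℓ ] (P I ℓ × Q I ℓ × R I ℓ)

  record IsConfiguration (v k : ℕ) : Set where
    field
      points       : HasSize Point v
      lines        : HasSize Line v
      pointsOnLine : ∀ ℓ → HasCard (λ P → P I ℓ) k
      linesOnPoint : ∀ P → HasCard (λ ℓ → P I ℓ) k
      atMostOne    : ∀ P Q ℓ m → P ≢ Q → P I ℓ → Q I ℓ → P I m → Q I m → ℓ ≡ m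

  PointAdj : Point → Point → Set
  PointAdj P Q = P ≢ Q × Collinear P Q

  IsAlphaBetaGeometry : Set
  IsAlphaBetaGeometry =
    ∃[ α ] ∃[ β ] (∀ P ℓ → ¬ (P I ℓ) →
      HasCard (λ Q → Q I ℓ × Collinear P Q) α ⊎ HasCard (λ Q → Q I ℓ × Collinear P Q) β)

  record IsProjectivePlane (n : ℕ) : Set where
    field
      lineThrough    : ∀ P Q → P ≢ Q → Collinear P Q
      lineUnique     : ∀ P Q ℓ m → P ≢ Q → P I ℓ → Q I ℓ → P I m → Q I m → ℓ ≡ m
      meet           : ∀ ℓ m → ℓ ≢ m → ∃[ P ] (P I ℓ × P I m)
      meetUnique     : ∀ ℓ m P Q → ℓ ≢ m → P I ℓ → P I m → Q I ℓ → Q I m → P ≡ Q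
      nondegenerate  : ∃[ a ] ∃[ b ] ∃[ c ] ∃[ d ]
                         (a ≢ b × a ≢ c × a ≢ d × b ≢ c × b ≢ d × c ≢ d ×
                          ¬ Collinear₃ a b c × ¬ Collinear₃ a b d ×
                          ¬ Collinear₃ a c d × ¬ Collinear₃ b c d)
      order          : ∀ ℓ → HasCard (λ P → P I ℓ) (suc n)

record Graph : Set₁ where
  field
    V   : Set
    Adj : V → V → Set

record IsSRG (G : Graph) (v k λ' μ : ℕ) : Set where
  open Graph G
  field
    size    : HasSize V v
    regular : ∀ x → HasCard (Adj x) k
    lambda  : ∀ x y → x ≢ y → Adj x y → HasCard (λ z → Adj x z × Adj y z) λ'
    mu      : ∀ x y → x ≢ y → ¬ Adj x y → HasCard (λ z → Adj x z × Adj y z) μ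

pointGraph : IncStr → Graph
pointGraph S = record { V = IncStr.Point S ; Adj = PointAdj S }

IsStronglyRegularConfiguration : IncStr → ℕ → ℕ → ℕ → ℕ → Set
IsStronglyRegularConfiguration S v k λ' μ =
  IsConfiguration S v k × IsSRG (pointGraph S) v (k * (k ∸ 1)) λ' μ

deleteTriangle : (S : IncStr) → (A B C : IncStr.Point S) → IncStr
deleteTriangle S A B C = record
  { Point = Refinement Point (λ X → ¬ Collinear₃ S A B X × ¬ Collinear₃ S A C X × ¬ Collinear₃ S B C X)
  ; Line  = Refinement Line (λ ℓ → ¬ (A I ℓ) × ¬ (B I ℓ) × ¬ (C I ℓ))
  ; _I_   = λ P ℓ → value P I value ℓ
  }
  where open IncStr S

module Submission where

-- Write a = BC, b = CA, c = AB and n = 5 + k.  The kept points are those off the three sides, and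
-- X ↦ (AX ∩ a, BX ∩ b) is a bijection onto pairs of non-vertex points of a and b, so there are (n - 1)²
-- of them; dually ℓ ↦ (ℓ ∩ c, ℓ ∩ b) counts the kept lines, and every kept line (point) is incident with
-- n - 2 kept points (lines).  For kept X ≠ Y, a common neighbour Z off XY is the meet of a kept line through
-- X and a kept line through Y, both different from XY, that meet off the sides.  The pairs of such lines
-- meeting on a side are counted by their meeting point, a point of that side minus a few exclusions, and
-- subtracting them from all pairs (and adding the kept points of XY when X ~ Y) gives λ and μ.  Finally, a
-- kept point P sees on a kept line ℓ ∌ P all kept points of ℓ except those of the feet PA ∩ ℓ, PB ∩ ℓ,
-- PC ∩ ℓ that are kept, and PA ∩ ℓ is kept iff ℓ misses AP ∩ a.  Lines through exactly one, none, and two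
-- of AP ∩ a, BP ∩ b, CP ∩ c give the three different counts n - 4, n - 5 and n - 3 or n - 2.

open import Defs
open import Data.Nat using (ℕ; suc; pred; _+_; _*_; _^_; _∸_; _≤_; _<_; z≤n; s≤s)
open import Data.Nat.Properties using (≤-antisym; +-suc; +-cancelˡ-≡; *-identityʳ; <⇒≱; m≤m+n; m≢1+n+m)
open import Data.Nat.Tactic.RingSolver using (solve-∀)
open import Data.Product using (Σ; _×_; _,_; proj₁; proj₂; uncurry)
open import Data.Product.Properties using (,-injectiveʳ)
open import Data.Sum using (_⊎_; inj₁; inj₂; [_,_]′) renaming (map to map-⊎)
open import Data.Unit using (tt)
open import Function using (_∘_)
open import Data.Empty using (⊥; ⊥-elim)
import Data.Empty.Irrelevant as Irr
open import Data.List using (List; []; _∷_; length; _++_; map)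
open import Data.List.Properties using (length-++; length-map)
open import Data.List.Relation.Unary.All as All using (All; []; _∷_)
open import Data.List.Relation.Unary.All.Properties using (++⁺)
open import Data.List.Relation.Unary.Any using (here; there)
open import Data.List.Relation.Unary.AllPairs using (_∷_)
open import Data.List.Relation.Unary.Unique.Propositional using (Unique; [])
import Data.List.Relation.Unary.Unique.Propositional.Properties as Unique
open import Data.List.Membership.Propositional using (_∈_; _∉_)
open import Data.List.Membership.Propositional.Properties
  using (∈-++⁺ˡ; ∈-++⁺ʳ; ∈-++⁻; ∈-map⁺; ∈-map⁻)
open import Data.Refinement using (Refinement; _,_; value; value-injective)
open import Data.Irrelevant using ([_])
open import Relation.Nullary using (¬_; Dec; yes; no)
open import Relation.Binary.PropositionalEquality

pred-if : {B : Set} → Dec B → ℕ → ℕ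
pred-if (yes _) m = pred m
pred-if (no _)  m = m

module _ {A : Set} where

  delete : (xs : List A) {x : A} → x ∈ xs → List A
  delete (y ∷ ys) (here _)  = ys
  delete (y ∷ ys) (there p) = y ∷ delete ys p

  ∈-delete⁻ : ∀ xs {x} (p : x ∈ xs) {y} → y ∈ delete xs p → y ∈ xs
  ∈-delete⁻ (z ∷ zs) (here _)  q         = there q
  ∈-delete⁻ (z ∷ zs) (there p) (here e)  = here e
  ∈-delete⁻ (z ∷ zs) (there p) (there q) = there (∈-delete⁻ zs p q)

  ∈-delete⁺ : ∀ xs {x y} (p : x ∈ xs) → y ∈ xs → y ≢ x → y ∈ delete xs p
  ∈-delete⁺ (z ∷ zs) (here e)  (here e') y≢x = ⊥-elim (y≢x (trans e' (sym e)))
  ∈-delete⁺ (z ∷ zs) (here e)  (there q) y≢x = q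
  ∈-delete⁺ (z ∷ zs) (there p) (here e') y≢x = here e'
  ∈-delete⁺ (z ∷ zs) (there p) (there q) y≢x = there (∈-delete⁺ zs p q y≢x)

  length-delete : ∀ xs {x} (p : x ∈ xs) → suc (length (delete xs p)) ≡ length xs
  length-delete (z ∷ zs) (here _)  = refl
  length-delete (z ∷ zs) (there p) = cong suc (length-delete zs p)

  delete-unique : ∀ xs {x} (p : x ∈ xs) → Unique xs → Unique (delete xs p)
  delete-unique (z ∷ zs) (here _)  (_ ∷ u)     = u
  delete-unique (z ∷ zs) (there p) (z∉zs ∷ u) =
    All.tabulate (λ q → All.lookup z∉zs (∈-delete⁻ zs p q)) ∷ delete-unique zs p u

  ∈-delete⇒≢ : ∀ xs {x} (p : x ∈ xs) → Unique xs → ∀ {y} → y ∈ delete xs p → y ≢ x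
  ∈-delete⇒≢ (z ∷ zs) (here e)  (z∉zs ∷ u) q        refl = All.lookup z∉zs q (sym e)
  ∈-delete⇒≢ (z ∷ zs) (there p) (z∉zs ∷ u) (here e) refl = All.lookup z∉zs p (sym e)
  ∈-delete⇒≢ (z ∷ zs) (there p) (z∉zs ∷ u) (there q)     = ∈-delete⇒≢ zs p u q

  unique-⊆⇒length≤ : ∀ {xs ys : List A} → Unique xs → (∀ {y} → y ∈ xs → y ∈ ys) →
                     length xs ≤ length ys
  unique-⊆⇒length≤ {[]}     _            _  = z≤n
  unique-⊆⇒length≤ {x ∷ xs} {ys} (x∉xs ∷ u) xs⊆ys =
    subst (_ ≤_) (length-delete ys x∈ys)
      (s≤s (unique-⊆⇒length≤ u λ q →
        ∈-delete⁺ ys x∈ys (xs⊆ys (there q)) (λ e → All.lookup x∉xs q (sym e))))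
    where x∈ys = xs⊆ys (here refl)

  module _ {P : A → Set} where

    card-unique : ∀ {m n} → HasCard P m → HasCard P n → m ≡ n
    card-unique (xs , refl , uxs , Pxs , xs-complete) (ys , refl , uys , Pys , ys-complete) =
      ≤-antisym (unique-⊆⇒length≤ uxs (λ q → ys-complete _ (All.lookup Pxs q)))
                (unique-⊆⇒length≤ uys (λ q → xs-complete _ (All.lookup Pys q)))

    card-remove : ∀ {m} → HasCard P m → ∀ {x} → P x → HasCard (λ y → P y × y ≢ x) (pred m)
    card-remove (xs , refl , u , Pxs , complete) {x} Px =
      delete xs x∈xs , cong pred (length-delete xs x∈xs) , delete-unique xs x∈xs u ,
      All.tabulate (λ q → All.lookup Pxs (∈-delete⁻ xs x∈xs q) , ∈-delete⇒≢ xs x∈xs u q) ,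
      λ y (Py , y≢x) → ∈-delete⁺ xs x∈xs (complete y Py) y≢x
      where x∈xs = complete x Px

    card-suc⇒inhabited : ∀ {m} → HasCard P (suc m) → Σ A P
    card-suc⇒inhabited (x ∷ _ , _ , _ , Px ∷ _ , _) = x , Px

    card⇒≡-dec : ∀ {m} → HasCard P m → ∀ {x y} → P x → P y → Dec (x ≡ y)
    card⇒≡-dec (xs , _ , u , _ , complete) Px Py = go u (complete _ Px) (complete _ Py)
      where
      go : ∀ {xs x y} → Unique xs → x ∈ xs → y ∈ xs → Dec (x ≡ y)
      go (x∉ ∷ u) (here e₁)  (here e₂)  = yes (trans e₁ (sym e₂))
      go (x∉ ∷ u) (here e₁)  (there q)  = no (λ e → All.lookup x∉ q (trans (sym e₁) e))
      go (x∉ ∷ u) (there p)  (here e₂)  = no (λ e → All.lookup x∉ p (trans (sym e₂) (sym e)))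
      go (x∉ ∷ u) (there p)  (there q)  = go u p q

    private
      ∈-decide : ∀ {y} {fs : List A} → (∀ {f} → f ∈ fs → Dec (y ≡ f)) → Dec (y ∈ fs)
      ∈-decide {fs = []}     _   = no (λ ())
      ∈-decide {fs = f ∷ fs} y≟ with y≟ (here refl) | ∈-decide (λ q → y≟ (there q))
      ... | yes e | _     = yes (here e)
      ... | no _  | yes q = yes (there q)
      ... | no ne | no nq = no λ { (here e) → ne e ; (there q) → nq q }

      outside-or-⊆ : ∀ {fs} → (∀ {y f} → P y → f ∈ fs → Dec (y ≡ f)) → ∀ zs → All P zs →
                     Σ A (λ y → y ∈ zs × y ∉ fs) ⊎ (∀ {y} → y ∈ zs → y ∈ fs)
      outside-or-⊆ _≟_ []       _          = inj₂ (λ ())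
      outside-or-⊆ _≟_ (z ∷ zs) (Pz ∷ Pzs)
        with ∈-decide (Pz ≟_) | outside-or-⊆ _≟_ zs Pzs
      ... | no z∉fs | _                   = inj₁ (z , here refl , z∉fs)
      ... | yes _   | inj₁ (y , q , y∉fs) = inj₁ (y , there q , y∉fs)
      ... | yes z∈  | inj₂ zs⊆fs          = inj₂ λ { (here refl) → z∈ ; (there q) → zs⊆fs q }

    card-avoid : ∀ {m} → HasCard P m → (fs : List A) → length fs < m →
                 (∀ {y f} → P y → f ∈ fs → Dec (y ≡ f)) → Σ A λ y → P y × y ∉ fs
    card-avoid (xs , refl , u , Pxs , _) fs fs<xs _≟_ with outside-or-⊆ _≟_ xs Pxs
    ... | inj₁ (y , q , y∉fs) = y , All.lookup Pxs q , y∉fs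
    ... | inj₂ xs⊆fs         = ⊥-elim (<⇒≱ fs<xs (unique-⊆⇒length≤ u xs⊆fs))

  card-⇔ : ∀ {P Q : A → Set} {m} → (∀ x → P x → Q x) → (∀ x → Q x → P x) →
           HasCard P m → HasCard Q m
  card-⇔ P⇒Q Q⇒P (xs , len , u , Pxs , complete) =
    xs , len , u , All.map (λ {x} → P⇒Q x) Pxs , λ x Qx → complete x (Q⇒P x Qx)

  card-remove? : ∀ {R : A → Set} {m x} → HasCard R m → (R? : Dec (R x)) →
                 HasCard (λ y → R y × y ≢ x) (pred-if R? m)
  card-remove? h (yes Rx) = card-remove h Rx
  card-remove? {R} h (no ¬Rx) = card-⇔ (λ y Ry → Ry , λ { refl → ¬Rx Ry }) (λ _ → proj₁) h

  card-single : (x : A) → HasCard (_≡ x) 1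
  card-single x = x ∷ [] , refl , [] ∷ [] , refl ∷ [] , λ { _ refl → here refl }

  card-⊎ : ∀ {P Q : A → Set} {m n} → HasCard P m → HasCard Q n → (∀ x → P x → ¬ Q x) →
           HasCard (λ x → P x ⊎ Q x) (m + n)
  card-⊎ (xs , refl , uxs , Pxs , xs-complete) (ys , refl , uys , Qys , ys-complete) P⇒¬Q =
    xs ++ ys , length-++ xs , Unique.++⁺ uxs uys disjoint ,
    ++⁺ (All.map inj₁ Pxs) (All.map inj₂ Qys) ,
    λ { x (inj₁ Px) → ∈-++⁺ˡ (xs-complete x Px) ; x (inj₂ Qx) → ∈-++⁺ʳ xs (ys-complete x Qx) }
    where
    disjoint : ∀ {v} → ¬ (v ∈ xs × v ∈ ys)
    disjoint (p , q) = P⇒¬Q _ (All.lookup Pxs p) (All.lookup Qys q)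

  private
    partition-∈ : ∀ {Q : A → Set} xs → Unique xs → (∀ {x} → x ∈ xs → Dec (Q x)) →
                  Σ ℕ λ k₁ → Σ ℕ λ k₂ → HasCard (λ x → x ∈ xs × Q x) k₁ ×
                  HasCard (λ x → x ∈ xs × ¬ Q x) k₂ × k₁ + k₂ ≡ length xs
    partition-∈ [] _ _ = 0 , 0 , empty , empty , refl
      where
      empty : ∀ {R : A → Set} → HasCard (λ x → x ∈ [] × R x) 0
      empty = [] , refl , [] , [] , λ { _ (() , _) }
    partition-∈ {Q} (x ∷ xs) (x∉xs ∷ u) Q?
      with partition-∈ xs u (λ q → Q? (there q)) | Q? (here refl)
    ... | k₁ , k₂ , yes₁ , no₂ , k₁+k₂ | yes Qx =
      suc k₁ , k₂ ,
      card-⇔ (λ { y (inj₁ refl) → here refl , Qx ; y (inj₂ (q , Qy)) → there q , Qy })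
             (λ { y (here refl , _) → inj₁ refl ; y (there q , Qy) → inj₂ (q , Qy) })
             (card-⊎ (card-single x) yes₁ (λ { y refl (q , _) → All.lookup x∉xs q refl })) ,
      card-⇔ (λ { y (q , ¬Qy) → there q , ¬Qy })
             (λ { y (here refl , ¬Qy) → ⊥-elim (¬Qy Qx) ; y (there q , ¬Qy) → q , ¬Qy }) no₂ ,
      cong suc k₁+k₂
    ... | k₁ , k₂ , yes₁ , no₂ , k₁+k₂ | no ¬Qx =
      k₁ , suc k₂ ,
      card-⇔ (λ { y (q , Qy) → there q , Qy })
             (λ { y (here refl , Qy) → ⊥-elim (¬Qx Qy) ; y (there q , Qy) → q , Qy }) yes₁ ,
      card-⇔ (λ { y (inj₁ refl) → here refl , ¬Qx ; y (inj₂ (q , ¬Qy)) → there q , ¬Qy })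
             (λ { y (here refl , _) → inj₁ refl ; y (there q , ¬Qy) → inj₂ (q , ¬Qy) })
             (card-⊎ (card-single x) no₂ (λ { y refl (q , _) → All.lookup x∉xs q refl })) ,
      trans (+-suc k₁ k₂) (cong suc k₁+k₂)

  card-partition : ∀ {P Q : A → Set} {m} → HasCard P m → (∀ {x} → P x → Dec (Q x)) →
                   Σ ℕ λ k₁ → Σ ℕ λ k₂ → HasCard (λ x → P x × Q x) k₁ ×
                   HasCard (λ x → P x × ¬ Q x) k₂ × k₁ + k₂ ≡ m
  card-partition {P} {Q} (xs , refl , u , Pxs , complete) Q?
    with partition-∈ {Q} xs u (λ q → Q? (All.lookup Pxs q))
  ... | k₁ , k₂ , h₁ , h₂ , k₁+k₂ = k₁ , k₂ , restrict h₁ , restrict h₂ , k₁+k₂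
    where
    restrict : ∀ {R : A → Set} {k} → HasCard (λ x → x ∈ xs × R x) k → HasCard (λ x → P x × R x) k
    restrict = card-⇔ (λ { x (q , Rx) → All.lookup Pxs q , Rx }) (λ { x (Px , Rx) → complete x Px , Rx })

module _ {A B : Set} {P : A → Set} {Q : B → Set} where

  card-bijection : ∀ {m} → HasCard P m → (f : ∀ x → P x → B) →
                   (∀ x p p′ → f x p ≡ f x p′) → (∀ x p → Q (f x p)) →
                   (∀ x x′ p p′ → f x p ≡ f x′ p′ → x ≡ x′) →
                   (∀ y → Q y → Σ A λ x → Σ (P x) λ p → f x p ≡ y) → HasCard Q m
  card-bijection (xs , refl , u , Pxs , complete) f f-irrelevant f-into f-injective f-onto =
    image xs Pxs , length-image xs Pxs , image-unique xs u Pxs , image-into xs Pxs ,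
    λ y Qy → let x , Px , fx≡y = f-onto y Qy in
             subst (_∈ image xs Pxs) fx≡y (∈-image⁺ xs Pxs (complete x Px) Px)
    where
    image : (xs : List A) → All P xs → List B
    image []       []         = []
    image (x ∷ xs) (Px ∷ Pxs) = f x Px ∷ image xs Pxs

    length-image : ∀ xs Pxs → length (image xs Pxs) ≡ length xs
    length-image []       []         = refl
    length-image (x ∷ xs) (Px ∷ Pxs) = cong suc (length-image xs Pxs)

    ∈-image⁻ : ∀ xs Pxs {y} → y ∈ image xs Pxs → Σ A λ x → x ∈ xs × Σ (P x) λ Px → y ≡ f x Px
    ∈-image⁻ (x ∷ xs) (Px ∷ Pxs) (here e)  = x , here refl , Px , e
    ∈-image⁻ (x ∷ xs) (Px ∷ Pxs) (there q) =
      let x′ , q′ , Px′ , e = ∈-image⁻ xs Pxs q in x′ , there q′ , Px′ , e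

    ∈-image⁺ : ∀ xs Pxs {x} → x ∈ xs → (Px : P x) → f x Px ∈ image xs Pxs
    ∈-image⁺ (x ∷ xs) (Px ∷ Pxs) (here refl) Px′ = here (f-irrelevant x Px′ Px)
    ∈-image⁺ (x ∷ xs) (Px ∷ Pxs) (there q)   Px′ = there (∈-image⁺ xs Pxs q Px′)

    image-unique : ∀ xs → Unique xs → (Pxs : All P xs) → Unique (image xs Pxs)
    image-unique []       _            []         = []
    image-unique (x ∷ xs) (x∉xs ∷ u) (Px ∷ Pxs) =
      All.tabulate (λ q e → let x′ , q′ , Px′ , e′ = ∈-image⁻ xs Pxs q in
                            All.lookup x∉xs q′ (f-injective x x′ Px Px′ (trans e e′)))
      ∷ image-unique xs u Pxs

    image-into : ∀ xs Pxs → All Q (image xs Pxs)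
    image-into []       []         = []
    image-into (x ∷ xs) (Px ∷ Pxs) = f-into x Px ∷ image-into xs Pxs

module _ {A B : Set} {P : A → Set} {Q : A → B → Set} where

  card-Σ : ∀ {m n} → HasCard P m → (∀ x → P x → HasCard (Q x) n) →
           HasCard {A × B} (λ (x , y) → P x × Q x y) (m * n)
  card-Σ {n = n} (xs , refl , u , Pxs , complete) fibre =
    pairs xs Pxs , length-pairs xs Pxs , pairs-unique xs u Pxs , pairs-into xs Pxs ,
    λ (x , y) (Px , Qxy) → ∈-pairs⁺ xs Pxs (complete x Px) Px Qxy
    where
    ys : ∀ x → P x → List B
    ys x Px = proj₁ (fibre x Px)

    pairs : (xs : List A) → All P xs → List (A × B)
    pairs []       []         = []
    pairs (x ∷ xs) (Px ∷ Pxs) = map (x ,_) (ys x Px) ++ pairs xs Pxs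

    length-pairs : ∀ xs Pxs → length (pairs xs Pxs) ≡ length xs * n
    length-pairs []       []         = refl
    length-pairs (x ∷ xs) (Px ∷ Pxs) =
      trans (length-++ (map (x ,_) (ys x Px)))
            (cong₂ _+_ (trans (length-map (x ,_) (ys x Px)) (proj₁ (proj₂ (fibre x Px))))
                       (length-pairs xs Pxs))

    ∈-pairs⇒∈ : ∀ xs Pxs {z} → z ∈ pairs xs Pxs → proj₁ z ∈ xs
    ∈-pairs⇒∈ (x ∷ xs) (Px ∷ Pxs) q with ∈-++⁻ (map (x ,_) (ys x Px)) q
    ... | inj₁ q₁ with ∈-map⁻ (x ,_) q₁
    ...   | _ , _ , refl = here refl
    ∈-pairs⇒∈ (x ∷ xs) (Px ∷ Pxs) q | inj₂ q₂ = there (∈-pairs⇒∈ xs Pxs q₂)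

    pairs-unique : ∀ xs → Unique xs → (Pxs : All P xs) → Unique (pairs xs Pxs)
    pairs-unique []       _            []         = []
    pairs-unique (x ∷ xs) (x∉xs ∷ u) (Px ∷ Pxs) =
      Unique.++⁺ (Unique.map⁺ ,-injectiveʳ (proj₁ (proj₂ (proj₂ (fibre x Px)))))
                 (pairs-unique xs u Pxs) disjoint
      where
      disjoint : ∀ {z} → ¬ (z ∈ map (x ,_) (ys x Px) × z ∈ pairs xs Pxs)
      disjoint (q₁ , q₂) with ∈-map⁻ (x ,_) q₁
      ... | _ , _ , refl = All.lookup x∉xs (∈-pairs⇒∈ xs Pxs q₂) refl

    pairs-into : ∀ xs Pxs → All (λ (x , y) → P x × Q x y) (pairs xs Pxs)
    pairs-into []       []         = []
    pairs-into (x ∷ xs) (Px ∷ Pxs) =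
      ++⁺ (All.tabulate λ q → let y , q′ , e = ∈-map⁻ (x ,_) q in
                              subst (λ (x , y) → P x × Q x y) (sym e)
                                    (Px , All.lookup (proj₁ (proj₂ (proj₂ (proj₂ (fibre x Px))))) q′))
          (pairs-into xs Pxs)

    ∈-pairs⁺ : ∀ xs Pxs {x y} → x ∈ xs → (Px : P x) → Q x y → (x , y) ∈ pairs xs Pxs
    ∈-pairs⁺ (x ∷ xs) (Px ∷ Pxs) (here refl) _ Qxy =
      ∈-++⁺ˡ (∈-map⁺ (x ,_) (proj₂ (proj₂ (proj₂ (proj₂ (fibre x Px)))) _ Qxy))
    ∈-pairs⁺ (x ∷ xs) (Px ∷ Pxs) (there q) Px′ Qxy =
      ∈-++⁺ʳ (map (x ,_) (ys x Px)) (∈-pairs⁺ xs Pxs q Px′ Qxy)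

irrelevant-¬ : {P : Set} → .(¬ P) → ¬ P
irrelevant-¬ ¬P P = Irr.⊥-elim (¬P P)

module _ {A : Set} {P : A → Set} where

  refine : ∀ x → P x → Refinement A P
  refine x Px = x , [ Px ]

module _ {A : Set} {P : A → Set} {R : A → Set} where

  card-refine : ∀ {m} → (∀ (r : Refinement A P) → P (value r)) →
                HasCard (λ x → P x × R x) m → HasCard {Refinement A P} (λ r → R (value r)) m
  card-refine recover h =
    card-bijection h (λ x p → refine x (proj₁ p)) (λ _ _ _ → refl) (λ _ → proj₂)
      (λ _ _ _ _ → cong value) (λ r Rr → value r , (recover r , Rr) , refl)

  card-unrefine : ∀ {m} → (∀ (r : Refinement A P) → P (value r)) →
                  HasCard {Refinement A P} (λ r → R (value r)) m → HasCard (λ x → P x × R x) m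
  card-unrefine recover h =
    card-bijection h (λ r _ → value r) (λ _ _ _ → refl) (λ r Rr → recover r , Rr)
      (λ _ _ _ _ → value-injective) (λ x (Px , Rx) → refine x Px , Rx , refl)

module _ {A : Set} {α β : A} where

  no-three-distinct-in-pair : ∀ {x y z} → x ≢ y → x ≢ z → y ≢ z →
                              x ≡ α ⊎ x ≡ β → y ≡ α ⊎ y ≡ β → z ≡ α ⊎ z ≡ β → ⊥
  no-three-distinct-in-pair x≢y _   _   (inj₁ x≡α) (inj₁ y≡α) _          = x≢y (trans x≡α (sym y≡α))
  no-three-distinct-in-pair x≢y _   _   (inj₂ x≡β) (inj₂ y≡β) _          = x≢y (trans x≡β (sym y≡β))
  no-three-distinct-in-pair _   x≢z _   (inj₁ x≡α) (inj₂ _)   (inj₁ z≡α) = x≢z (trans x≡α (sym z≡α))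
  no-three-distinct-in-pair _   _   y≢z (inj₁ _)   (inj₂ y≡β) (inj₂ z≡β) = y≢z (trans y≡β (sym z≡β))
  no-three-distinct-in-pair _   _   y≢z (inj₂ _)   (inj₁ y≡α) (inj₁ z≡α) = y≢z (trans y≡α (sym z≡α))
  no-three-distinct-in-pair _   x≢z _   (inj₂ x≡β) (inj₁ _)   (inj₂ z≡β) = x≢z (trans x≡β (sym z≡β))

cancel-three : ∀ {x y z r s t} → x + (y + (z + r)) ≡ t → t ≡ x + (y + (z + s)) → r ≡ s
cancel-three {x} {y} {z} eq₁ eq₂ = +-cancelˡ-≡ z _ _ (+-cancelˡ-≡ y _ _ (+-cancelˡ-≡ x _ _ (trans eq₁ eq₂)))

λ-square : ∀ k → (2 + k) * (2 + k) ≡ (1 + k) + ((1 + k) + ((1 + k) + (k * (1 + k) + 1)))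
λ-square = solve-∀

λ-total : ∀ k → (1 + k) + (k * (1 + k) + 1) ≡ (1 + k) * ((1 + k) * 1) + 1
λ-total = solve-∀

μ-square₁ : ∀ k → (3 + k) * (3 + k) ≡ (3 + k) + ((2 + k) + ((2 + k) + (2 + k) * (1 + k)))
μ-square₁ = solve-∀

μ-square₂ : ∀ k → (3 + k) * (3 + k) ≡ (2 + k) + ((3 + k) + ((2 + k) + (2 + k) * (1 + k)))
μ-square₂ = solve-∀

μ-square₃ : ∀ k → (3 + k) * (3 + k) ≡ (2 + k) + ((2 + k) + ((3 + k) + (2 + k) * (1 + k)))
μ-square₃ = solve-∀

module ProjectivePlane (𝒫 : IncStr) {n : ℕ} (pp : IsProjectivePlane 𝒫 n) where
  open IncStr 𝒫 public
  open IsProjectivePlane pp using (lineThrough; meetUnique; order)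

  line-unique : ∀ {P Q ℓ m} → P ≢ Q → P I ℓ → Q I ℓ → P I m → Q I m → ℓ ≡ m
  line-unique = IsProjectivePlane.lineUnique pp _ _ _ _

  point-unique : ∀ {ℓ m P Q} → ℓ ≢ m → P I ℓ → P I m → Q I ℓ → Q I m → P ≡ Q
  point-unique = meetUnique _ _ _ _

  lines-≢ : ∀ {P ℓ m} → P I ℓ → ¬ P I m → ℓ ≢ m
  lines-≢ Pℓ P∉m refl = P∉m Pℓ

  points-≢ : ∀ {P Q ℓ} → P I ℓ → ¬ Q I ℓ → P ≢ Q
  points-≢ Pℓ Q∉ℓ refl = Q∉ℓ Pℓ

  I-respˡ : ∀ {P Q ℓ} → P ≡ Q → P I ℓ → Q I ℓ
  I-respˡ refl Pℓ = Pℓ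

  I-respʳ : ∀ {P ℓ m} → ℓ ≡ m → P I ℓ → P I m
  I-respʳ refl Pℓ = Pℓ

  join : (P Q : Point) → P ≢ Q → Line
  join P Q P≢Q = proj₁ (lineThrough P Q P≢Q)

  on-joinˡ : ∀ {P Q} (P≢Q : P ≢ Q) → P I join P Q P≢Q
  on-joinˡ P≢Q = proj₁ (proj₂ (lineThrough _ _ P≢Q))

  on-joinʳ : ∀ {P Q} (P≢Q : P ≢ Q) → Q I join P Q P≢Q
  on-joinʳ P≢Q = proj₂ (proj₂ (lineThrough _ _ P≢Q))

  join-unique : ∀ {P Q ℓ} (P≢Q : P ≢ Q) → P I ℓ → Q I ℓ → join P Q P≢Q ≡ ℓ
  join-unique P≢Q = line-unique P≢Q (on-joinˡ P≢Q) (on-joinʳ P≢Q)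

  join-irrelevant : ∀ {P Q} (P≢Q P≢Q′ : P ≢ Q) → join P Q P≢Q ≡ join P Q P≢Q′
  join-irrelevant P≢Q P≢Q′ = join-unique P≢Q (on-joinˡ P≢Q′) (on-joinʳ P≢Q′)

  meet : (ℓ m : Line) → ℓ ≢ m → Point
  meet ℓ m ℓ≢m = proj₁ (IsProjectivePlane.meet pp ℓ m ℓ≢m)

  on-meetˡ : ∀ {ℓ m} (ℓ≢m : ℓ ≢ m) → meet ℓ m ℓ≢m I ℓ
  on-meetˡ ℓ≢m = proj₁ (proj₂ (IsProjectivePlane.meet pp _ _ ℓ≢m))

  on-meetʳ : ∀ {ℓ m} (ℓ≢m : ℓ ≢ m) → meet ℓ m ℓ≢m I m
  on-meetʳ ℓ≢m = proj₂ (proj₂ (IsProjectivePlane.meet pp _ _ ℓ≢m))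

  meet-unique : ∀ {ℓ m X} (ℓ≢m : ℓ ≢ m) → X I ℓ → X I m → meet ℓ m ℓ≢m ≡ X
  meet-unique ℓ≢m = point-unique ℓ≢m (on-meetˡ ℓ≢m) (on-meetʳ ℓ≢m)

  ≟-on : ∀ ℓ {P Q} → P I ℓ → Q I ℓ → Dec (P ≡ Q)
  ≟-on ℓ = card⇒≡-dec (order ℓ)

  ≟-through : ∀ {X ℓ ℓ′ m} → ¬ X I m → X I ℓ → X I ℓ′ → Dec (ℓ ≡ ℓ′)
  ≟-through {X} {ℓ} {ℓ′} {m} X∉m Xℓ Xℓ′ with ≟-on m (on-meetʳ ℓ≢m) (on-meetʳ ℓ′≢m)
    where
    ℓ≢m : ℓ ≢ m
    ℓ≢m = lines-≢ Xℓ X∉m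
    ℓ′≢m : ℓ′ ≢ m
    ℓ′≢m = lines-≢ Xℓ′ X∉m
  ... | yes e  = yes (line-unique (λ e′ → X∉m (I-respˡ (sym e′) (on-meetʳ _))) Xℓ
                       (I-respˡ e (on-meetˡ _)) Xℓ′ (on-meetˡ _))
  ... | no ne = no (λ { refl → ne refl })

  Inner : Line → Point → Point → Point → Set
  Inner s V W Y = (Y I s × Y ≢ V) × Y ≢ W

  card-inner : ∀ {s V W} → V I s → W I s → W ≢ V → HasCard (Inner s V W) (pred n)
  card-inner Vs Ws W≢V = card-remove (card-remove (order _) Vs) (Ws , W≢V)

  avoid-on : ∀ s (fs : List Point) → All (_I s) fs → length fs < suc n →
             Σ Point λ y → y I s × y ∉ fs
  avoid-on s fs on-s fs<n =
    card-avoid (order s) fs fs<n (λ Ys Fs → ≟-on s Ys (All.lookup on-s Fs))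

-- The order is written 5 + k so that every count below is a closed term in k, free of truncated subtraction.
module Triangles {k : ℕ} (𝒫 : IncStr) (pp : IsProjectivePlane 𝒫 (5 + k)) where
  open ProjectivePlane 𝒫 pp public
  open IsProjectivePlane pp using (order)

  record Triangle : Set where
    field
      A B C : Point
      a b c : Line
      Ba : B I a
      Ca : C I a
      Ab : A I b
      Cb : C I b
      Ac : A I c
      Bc : B I c
      A∉a : ¬ A I a
      B∉b : ¬ B I b
      C∉c : ¬ C I c

  rotate : Triangle → Triangle
  rotate T = record
    { A = B ; B = C ; C = A ; a = b ; b = c ; c = a
    ; Ba = Cb ; Ca = Ab ; Ab = Bc ; Cb = Ac ; Ac = Ba ; Bc = Ca
    ; A∉a = B∉b ; B∉b = C∉c ; C∉c = A∉a }
    where open Triangle T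

  module Sides (T : Triangle) where
    open Triangle T public

    A≢B : A ≢ B
    A≢B = points-≢ Ab B∉b
    A≢C : A ≢ C
    A≢C = points-≢ Ac C∉c
    B≢C : B ≢ C
    B≢C = points-≢ Bc C∉c
    a≢b : a ≢ b
    a≢b = lines-≢ Ba B∉b
    a≢c : a ≢ c
    a≢c = lines-≢ Ca C∉c
    b≢c : b ≢ c
    b≢c = lines-≢ Cb C∉c

    a∩b≡C : ∀ {X} → X I a → X I b → X ≡ C
    a∩b≡C Xa Xb = point-unique a≢b Xa Xb Ca Cb
    a∩c≡B : ∀ {X} → X I a → X I c → X ≡ B
    a∩c≡B Xa Xc = point-unique a≢c Xa Xc Ba Bc
    b∩c≡A : ∀ {X} → X I b → X I c → X ≡ A
    b∩c≡A Xb Xc = point-unique b≢c Xb Xc Ab Ac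

    AB≡c : ∀ {ℓ} → A I ℓ → B I ℓ → ℓ ≡ c
    AB≡c Aℓ Bℓ = line-unique A≢B Aℓ Bℓ Ac Bc
    AC≡b : ∀ {ℓ} → A I ℓ → C I ℓ → ℓ ≡ b
    AC≡b Aℓ Cℓ = line-unique A≢C Aℓ Cℓ Ab Cb
    BC≡a : ∀ {ℓ} → B I ℓ → C I ℓ → ℓ ≡ a
    BC≡a Bℓ Cℓ = line-unique B≢C Bℓ Cℓ Ba Ca

    OffSides : Point → Set
    OffSides X = ¬ X I a × ¬ X I b × ¬ X I c

    OffVertices : Line → Set
    OffVertices ℓ = ¬ A I ℓ × ¬ B I ℓ × ¬ C I ℓ

    module _ {X : Point} (X-off : OffSides X) where
      ∉a : ¬ X I a
      ∉a = proj₁ X-off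
      ∉b : ¬ X I b
      ∉b = proj₁ (proj₂ X-off)
      ∉c : ¬ X I c
      ∉c = proj₂ (proj₂ X-off)
      A≢ : A ≢ X
      A≢ = points-≢ Ab ∉b
      B≢ : B ≢ X
      B≢ = points-≢ Ba ∉a
      C≢ : C ≢ X
      C≢ = points-≢ Ca ∉a

    module _ {ℓ : Line} (ℓ-off : OffVertices ℓ) where
      A∉ : ¬ A I ℓ
      A∉ = proj₁ ℓ-off
      B∉ : ¬ B I ℓ
      B∉ = proj₁ (proj₂ ℓ-off)
      C∉ : ¬ C I ℓ
      C∉ = proj₂ (proj₂ ℓ-off)
      ≢a : ℓ ≢ a
      ≢a = ≢-sym (lines-≢ Ba B∉)
      ≢b : ℓ ≢ b
      ≢b = ≢-sym (lines-≢ Ab A∉)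
      ≢c : ℓ ≢ c
      ≢c = ≢-sym (lines-≢ Ac A∉)

    Inner-a Inner-b Inner-c : Point → Set
    Inner-a = Inner a B C
    Inner-b = Inner b A C
    Inner-c = Inner c A B

    card-inner-a : HasCard Inner-a (4 + k)
    card-inner-a = card-inner Ba Ca (points-≢ Cb B∉b)
    card-inner-b : HasCard Inner-b (4 + k)
    card-inner-b = card-inner Ab Cb (points-≢ Ca A∉a)
    card-inner-c : HasCard Inner-c (4 + k)
    card-inner-c = card-inner Ac Bc (points-≢ Ba A∉a)

    A≢on-a : ∀ {Y} → Y I a → A ≢ Y
    A≢on-a Ya = ≢-sym (points-≢ Ya A∉a)
    B≢on-b : ∀ {Z} → Z I b → B ≢ Z
    B≢on-b Zb = ≢-sym (points-≢ Zb B∉b)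

    module _ {X : Point} (X-off : OffSides X) where
      AX≢a : join A X (A≢ X-off) ≢ a
      AX≢a = lines-≢ (on-joinˡ _) A∉a
      BX≢b : join B X (B≢ X-off) ≢ b
      BX≢b = lines-≢ (on-joinˡ _) B∉b
      CX≢c : join C X (C≢ X-off) ≢ c
      CX≢c = lines-≢ (on-joinˡ _) C∉c

      proj-a proj-b proj-c : Point
      proj-a = meet _ a AX≢a
      proj-b = meet _ b BX≢b
      proj-c = meet _ c CX≢c

      proj-a-inner : Inner-a proj-a
      proj-a-inner =
        (on-meetʳ AX≢a , λ e → ∉c X-off (I-respʳ (AB≡c (on-joinˡ _) (I-respˡ e (on-meetˡ AX≢a))) (on-joinʳ _))) ,
        λ e → ∉b X-off (I-respʳ (AC≡b (on-joinˡ _) (I-respˡ e (on-meetˡ AX≢a))) (on-joinʳ _))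

      proj-b-inner : Inner-b proj-b
      proj-b-inner =
        (on-meetʳ BX≢b , λ e → ∉c X-off (I-respʳ (line-unique (≢-sym A≢B) (on-joinˡ _) (I-respˡ e (on-meetˡ BX≢b)) Bc Ac)
                                                (on-joinʳ _))) ,
        λ e → ∉a X-off (I-respʳ (BC≡a (on-joinˡ _) (I-respˡ e (on-meetˡ BX≢b))) (on-joinʳ _))

      proj-c-inner : Inner-c proj-c
      proj-c-inner =
        (on-meetʳ CX≢c , λ e → ∉b X-off (I-respʳ (line-unique (≢-sym A≢C) (on-joinˡ _) (I-respˡ e (on-meetˡ CX≢c)) Cb Ab)
                                                (on-joinʳ _))) ,
        λ e → ∉a X-off (I-respʳ (line-unique (≢-sym B≢C) (on-joinˡ _) (I-respˡ e (on-meetˡ CX≢c)) Ca Ba) (on-joinʳ _))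

      X-on-A-proj-a : X I join A proj-a (A≢on-a (on-meetʳ AX≢a))
      X-on-A-proj-a = I-respʳ (sym (line-unique (A≢on-a (on-meetʳ AX≢a)) (on-joinˡ _) (on-joinʳ _)
                                                (on-joinˡ _) (on-meetˡ AX≢a))) (on-joinʳ _)

      X-on-B-proj-b : X I join B proj-b (B≢on-b (on-meetʳ BX≢b))
      X-on-B-proj-b = I-respʳ (sym (line-unique (B≢on-b (on-meetʳ BX≢b)) (on-joinˡ _) (on-joinʳ _)
                                                (on-joinˡ _) (on-meetˡ BX≢b))) (on-joinʳ _)

      proj-a-on⇒A-on : ∀ {ℓ} → X I ℓ → proj-a I ℓ → A I ℓ
      proj-a-on⇒A-on Xℓ X′ℓ = I-respʳ (sym (line-unique (≢-sym (points-≢ (on-meetʳ AX≢a) (∉a X-off))) Xℓ X′ℓ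
                                                       (on-joinʳ _) (on-meetˡ AX≢a))) (on-joinˡ _)

    module _ {Y Z : Point} (Y-in : Inner-a Y) (Z-in : Inner-b Z) where
      private
        Ya : Y I a
        Ya = proj₁ (proj₁ Y-in)
        Zb : Z I b
        Zb = proj₁ (proj₁ Z-in)

      AY BZ : Line
      AY = join A Y (A≢on-a Ya)
      BZ = join B Z (B≢on-b Zb)

      AY≢BZ : AY ≢ BZ
      AY≢BZ e = proj₂ (proj₁ Y-in) (a∩c≡B Ya (I-respʳ BZ≡c (I-respʳ e (on-joinʳ _))))
        where BZ≡c = AB≡c (I-respʳ e (on-joinˡ _)) (on-joinˡ _)

      AY∩BZ : Point
      AY∩BZ = meet AY BZ AY≢BZ

      AY∩BZ-off : OffSides AY∩BZ
      AY∩BZ-off = ∉a′ , ∉b′ , ∉c′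
        where
        X : Point
        X = AY∩BZ
        X∈AY : X I AY
        X∈AY = on-meetˡ AY≢BZ
        X∈BZ : X I BZ
        X∈BZ = on-meetʳ AY≢BZ
        ∉a′ : ¬ X I a
        ∉a′ Xa = proj₂ Z-in (a∩b≡C (I-respʳ (line-unique (≢-sym (proj₂ (proj₁ Y-in))) (on-joinˡ _) (I-respˡ X≡Y X∈BZ) Ba Ya)
                                            (on-joinʳ _)) Zb)
          where X≡Y = point-unique (lines-≢ (on-joinˡ _) A∉a) X∈AY Xa (on-joinʳ _) Ya
        ∉b′ : ¬ X I b
        ∉b′ Xb = proj₂ Y-in (a∩b≡C Ya (I-respʳ (line-unique (≢-sym (proj₂ (proj₁ Z-in))) (on-joinˡ _) (I-respˡ X≡Z X∈AY) Ab Zb)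
                                               (on-joinʳ _)))
          where X≡Z = point-unique (lines-≢ (on-joinˡ _) B∉b) X∈BZ Xb (on-joinʳ _) Zb
        ∉c′ : ¬ X I c
        ∉c′ Xc = proj₂ (proj₁ Z-in) (b∩c≡A Zb (I-respʳ (AB≡c (I-respˡ X≡A X∈BZ) (on-joinˡ _)) (on-joinʳ _)))
          where
          AY≢c : AY ≢ c
          AY≢c e = proj₂ (proj₁ Y-in) (a∩c≡B Ya (I-respʳ e (on-joinʳ _)))
          X≡A : X ≡ A
          X≡A = point-unique AY≢c X∈AY Xc (on-joinˡ _) Ac

    AY∩BZ-injective : ∀ {Y Z Y′ Z′} (p : Inner-a Y) (q : Inner-b Z) (p′ : Inner-a Y′) (q′ : Inner-b Z′) →
                      AY∩BZ p q ≡ AY∩BZ p′ q′ → Y ≡ Y′ × Z ≡ Z′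
    AY∩BZ-injective {Y} {Z} {Y′} {Z′} p q p′ q′ e = Y≡Y′ , Z≡Z′
      where
      X-off : OffSides (AY∩BZ p q)
      X-off = AY∩BZ-off p q
      AY≡AY′ : AY p q ≡ AY p′ q′
      AY≡AY′ = line-unique (≢-sym (A≢ X-off)) (on-meetˡ (AY≢BZ p q)) (on-joinˡ _)
                           (I-respˡ (sym e) (on-meetˡ (AY≢BZ p′ q′))) (on-joinˡ _)
      Y≡Y′ : Y ≡ Y′
      Y≡Y′ = point-unique (lines-≢ (on-joinˡ _) A∉a) (on-joinʳ _) (proj₁ (proj₁ p))
                          (I-respʳ (sym AY≡AY′) (on-joinʳ _)) (proj₁ (proj₁ p′))
      BZ≡BZ′ : BZ p q ≡ BZ p′ q′
      BZ≡BZ′ = line-unique (≢-sym (B≢ X-off)) (on-meetʳ (AY≢BZ p q)) (on-joinˡ _)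
                           (I-respˡ (sym e) (on-meetʳ (AY≢BZ p′ q′))) (on-joinˡ _)
      Z≡Z′ : Z ≡ Z′
      Z≡Z′ = point-unique (lines-≢ (on-joinˡ _) B∉b) (on-joinʳ _) (proj₁ (proj₁ q))
                          (I-respʳ (sym BZ≡BZ′) (on-joinʳ _)) (proj₁ (proj₁ q′))

    card-offSides : HasCard OffSides ((4 + k) * (4 + k))
    card-offSides = card-bijection (card-Σ card-inner-a (λ _ _ → card-inner-b))
                      (λ _ (Y-in , Z-in) → AY∩BZ Y-in Z-in) irrelevant (λ _ (Y-in , Z-in) → AY∩BZ-off Y-in Z-in)
                      (λ _ _ (p , q) (p′ , q′) e → uncurry (cong₂ _,_) (AY∩BZ-injective p q p′ q′ e)) onto
      where
      irrelevant : ∀ YZ (p p′ : Inner-a (proj₁ YZ) × Inner-b (proj₂ YZ)) →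
                   AY∩BZ (proj₁ p) (proj₂ p) ≡ AY∩BZ (proj₁ p′) (proj₂ p′)
      irrelevant _ (p , q) (p′ , q′) =
        meet-unique (AY≢BZ p′ q′) (I-respʳ (join-irrelevant _ _) (on-meetˡ (AY≢BZ p q)))
                                  (I-respʳ (join-irrelevant _ _) (on-meetʳ (AY≢BZ p q)))
      onto : ∀ X → OffSides X → Σ (Point × Point) λ YZ →
             Σ (Inner-a (proj₁ YZ) × Inner-b (proj₂ YZ)) λ p → AY∩BZ (proj₁ p) (proj₂ p) ≡ X
      onto X X-off = (proj-a X-off , proj-b X-off) , (proj-a-inner X-off , proj-b-inner X-off) ,
                     meet-unique _ (X-on-A-proj-a X-off) (X-on-B-proj-b X-off)

    module _ {U W : Point} (U-in : Inner-c U) (W-in : Inner-b W) where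
      U≢W : U ≢ W
      U≢W e = proj₂ (proj₁ W-in) (b∩c≡A (proj₁ (proj₁ W-in)) (I-respˡ e (proj₁ (proj₁ U-in))))

      UW-off : OffVertices (join U W U≢W)
      UW-off = A∉′ , B∉′ , C∉′
        where
        Uc = proj₁ (proj₁ U-in)
        Wb = proj₁ (proj₁ W-in)
        A∉′ : ¬ A I join U W U≢W
        A∉′ A∈ = proj₂ (proj₁ W-in)
          (b∩c≡A Wb (I-respʳ (line-unique (≢-sym (proj₂ (proj₁ U-in))) A∈ (on-joinˡ _) Ac Uc) (on-joinʳ _)))
        B∉′ : ¬ B I join U W U≢W
        B∉′ B∈ = proj₂ (proj₁ W-in)
          (b∩c≡A Wb (I-respʳ (line-unique (≢-sym (proj₂ U-in)) B∈ (on-joinˡ _) Bc Uc) (on-joinʳ _)))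
        C∉′ : ¬ C I join U W U≢W
        C∉′ C∈ = proj₂ (proj₁ U-in)
          (b∩c≡A (I-respʳ (line-unique (≢-sym (proj₂ W-in)) C∈ (on-joinʳ _) Cb Wb) (on-joinˡ _)) Uc)

    card-offVertices : HasCard OffVertices ((4 + k) * (4 + k))
    card-offVertices = card-bijection (card-Σ card-inner-c (λ _ _ → card-inner-b))
                         (λ _ (U-in , W-in) → join _ _ (U≢W U-in W-in)) (λ _ _ _ → join-irrelevant _ _)
                         (λ _ (U-in , W-in) → UW-off U-in W-in) injective onto
      where
      injective : ∀ UW UW′ (p : Inner-c (proj₁ UW) × Inner-b (proj₂ UW))
                  (p′ : Inner-c (proj₁ UW′) × Inner-b (proj₂ UW′)) →
                  join _ _ (U≢W (proj₁ p) (proj₂ p)) ≡ join _ _ (U≢W (proj₁ p′) (proj₂ p′)) → UW ≡ UW′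
      injective _ _ (p , q) (p′ , q′) e = cong₂ _,_
        (point-unique (≢c ℓ-off) (on-joinˡ _) (proj₁ (proj₁ p)) (I-respʳ (sym e) (on-joinˡ _)) (proj₁ (proj₁ p′)))
        (point-unique (≢b ℓ-off) (on-joinʳ _) (proj₁ (proj₁ q)) (I-respʳ (sym e) (on-joinʳ _)) (proj₁ (proj₁ q′)))
        where ℓ-off = UW-off p q
      onto : ∀ ℓ → OffVertices ℓ → Σ (Point × Point) λ UW →
             Σ (Inner-c (proj₁ UW) × Inner-b (proj₂ UW)) λ p → join _ _ (U≢W (proj₁ p) (proj₂ p)) ≡ ℓ
      onto ℓ ℓ-off = (meet ℓ c (≢c ℓ-off) , meet ℓ b (≢b ℓ-off)) , (U-in , W-in) ,
                     join-unique _ (on-meetˡ _) (on-meetˡ _)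
        where
        U-in : Inner-c (meet ℓ c (≢c ℓ-off))
        U-in = (on-meetʳ _ , λ e → A∉ ℓ-off (I-respˡ e (on-meetˡ _))) , λ e → B∉ ℓ-off (I-respˡ e (on-meetˡ _))
        W-in : Inner-b (meet ℓ b (≢b ℓ-off))
        W-in = (on-meetʳ _ , λ e → A∉ ℓ-off (I-respˡ e (on-meetˡ _))) , λ e → C∉ ℓ-off (I-respˡ e (on-meetˡ _))

    card-offSides-on : ∀ ℓ → OffVertices ℓ → HasCard (λ P → OffSides P × P I ℓ) (3 + k)
    card-offSides-on ℓ ℓ-off =
      card-⇔ (λ P (((Pℓ , ≢ℓa) , ≢ℓb) , ≢ℓc) →
                ((λ Pa → ≢ℓa (sym (meet-unique _ Pℓ Pa))) , (λ Pb → ≢ℓb (sym (meet-unique _ Pℓ Pb))) ,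
                 (λ Pc → ≢ℓc (sym (meet-unique _ Pℓ Pc)))) , Pℓ)
             (λ P (P-off , Pℓ) → ((Pℓ , λ { refl → ∉a P-off (on-meetʳ _) }) , λ { refl → ∉b P-off (on-meetʳ _) }) ,
                                 λ { refl → ∉c P-off (on-meetʳ _) })
             (card-remove (card-remove (card-remove (order ℓ) (on-meetˡ (≢a ℓ-off)))
                                       (on-meetˡ (≢b ℓ-off) , ≢-sym ℓa≢ℓb))
                          ((on-meetˡ (≢c ℓ-off) , ≢-sym ℓa≢ℓc) , ≢-sym ℓb≢ℓc))
      where
      ℓa ℓb ℓc : Point
      ℓa = meet ℓ a (≢a ℓ-off)
      ℓb = meet ℓ b (≢b ℓ-off)
      ℓc = meet ℓ c (≢c ℓ-off)
      ℓa≢ℓb : ℓa ≢ ℓb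
      ℓa≢ℓb e = C∉ ℓ-off (I-respˡ (a∩b≡C (on-meetʳ _) (I-respˡ (sym e) (on-meetʳ _))) (on-meetˡ _))
      ℓa≢ℓc : ℓa ≢ ℓc
      ℓa≢ℓc e = B∉ ℓ-off (I-respˡ (a∩c≡B (on-meetʳ _) (I-respˡ (sym e) (on-meetʳ _))) (on-meetˡ _))
      ℓb≢ℓc : ℓb ≢ ℓc
      ℓb≢ℓc e = A∉ ℓ-off (I-respˡ (b∩c≡A (on-meetʳ _) (I-respˡ (sym e) (on-meetʳ _))) (on-meetˡ _))

    module _ {X : Point} (X-off : OffSides X) where
      X≢on-a : ∀ {Q} → Q I a → X ≢ Q
      X≢on-a Qa refl = ∉a X-off Qa

      XQ-off : ∀ {Q} (Q-in : Inner-a Q) → Q ≢ proj-a X-off →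
               OffVertices (join X Q (X≢on-a (proj₁ (proj₁ Q-in))))
      XQ-off {Q} ((Qa , Q≢B) , Q≢C) Q≢X′ = A∉′ , B∉′ , C∉′
        where
        A∉′ : ¬ A I join X Q _
        A∉′ A∈ = Q≢X′ (sym (meet-unique (AX≢a X-off)
                   (I-respʳ (line-unique (≢-sym (A≢ X-off)) (on-joinˡ _) A∈ (on-joinʳ _) (on-joinˡ _)) (on-joinʳ _)) Qa))
        B∉′ : ¬ B I join X Q _
        B∉′ B∈ = ∉a X-off (I-respʳ (line-unique Q≢B (on-joinʳ _) B∈ Qa Ba) (on-joinˡ _))
        C∉′ : ¬ C I join X Q _
        C∉′ C∈ = ∉a X-off (I-respʳ (line-unique Q≢C (on-joinʳ _) C∈ Qa Ca) (on-joinˡ _))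

      through-meets-a : ∀ {m P} → OffVertices m → X I m → P I a → P I m → Inner-a P × P ≢ proj-a X-off
      through-meets-a m-off Xm Pa Pm =
        ((Pa , λ { refl → B∉ m-off Pm }) , λ { refl → C∉ m-off Pm }) ,
        λ e → A∉ m-off (I-respʳ (sym (line-unique (X≢on-a (on-meetʳ (AX≢a X-off))) Xm (I-respˡ e Pm)
                                                   (on-joinʳ _) (on-meetˡ (AX≢a X-off)))) (on-joinˡ _))

      card-offVertices-through : HasCard (λ ℓ → OffVertices ℓ × X I ℓ) (3 + k)
      card-offVertices-through =
        card-bijection (card-remove card-inner-a (proj-a-inner X-off))
          (λ _ (Y-in , _) → join X _ (X≢on-a (proj₁ (proj₁ Y-in)))) (λ _ _ _ → join-irrelevant _ _)
          (λ _ (Y-in , Y≢X′) → XQ-off Y-in Y≢X′ , on-joinˡ _)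
          (λ _ _ (Y-in , _) (Y′-in , _) e →
             point-unique (lines-≢ (on-joinˡ _) (∉a X-off)) (on-joinʳ _) (proj₁ (proj₁ Y-in))
                          (I-respʳ (sym e) (on-joinʳ _)) (proj₁ (proj₁ Y′-in)))
          (λ ℓ (ℓ-off , Xℓ) → meet ℓ a (≢a ℓ-off) ,
                                through-meets-a ℓ-off Xℓ (on-meetʳ _) (on-meetˡ _) ,
                                join-unique _ Xℓ (on-meetˡ _))

    Adjacent : Point → Point → Set
    Adjacent X Z = X ≢ Z × Σ Line λ ℓ → OffVertices ℓ × X I ℓ × Z I ℓ

    card-adjacent : ∀ X → OffSides X → HasCard (λ Z → OffSides Z × Adjacent X Z) ((3 + k) * (2 + k))
    card-adjacent X X-off =
      card-bijection
        (card-Σ (card-offVertices-through X-off)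
                (λ ℓ (ℓ-off , Xℓ) → card-remove (card-offSides-on ℓ ℓ-off) (X-off , Xℓ)))
        (λ (_ , Z) _ → Z) (λ _ _ _ → refl)
        (λ (ℓ , Z) ((ℓ-off , Xℓ) , ((Z-off , Zℓ) , Z≢X)) → Z-off , ≢-sym Z≢X , ℓ , ℓ-off , Xℓ , Zℓ)
        (λ { (ℓ , Z) (ℓ′ , .Z) ((_ , Xℓ) , ((_ , Zℓ) , Z≢X)) ((_ , Xℓ′) , ((_ , Zℓ′) , _)) refl →
               cong (_, Z) (line-unique (≢-sym Z≢X) Xℓ Zℓ Xℓ′ Zℓ′) })
        (λ Z (Z-off , X≢Z , ℓ , ℓ-off , Xℓ , Zℓ) → (ℓ , Z) , ((ℓ-off , Xℓ) , ((Z-off , Zℓ) , ≢-sym X≢Z)) , refl)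

    module CommonNeighbours (X Y : Point) (X-off : OffSides X) (Y-off : OffSides Y) (X≢Y : X ≢ Y) where
      XY : Line
      XY = join X Y X≢Y
      X∈XY : X I XY
      X∈XY = on-joinˡ X≢Y
      Y∈XY : Y I XY
      Y∈XY = on-joinʳ X≢Y

      Through : Point → Line → Set
      Through Z m = (OffVertices m × Z I m) × m ≢ XY

      LinePair : Line × Line → Set
      LinePair (m , m′) = Through X m × Through Y m′

      MeetOn : Line → Line × Line → Set
      MeetOn s (m , m′) = Σ Point λ P → P I s × P I m × P I m′

      LinePair⇒≢ : ∀ {m m′} → LinePair (m , m′) → m ≢ m′
      LinePair⇒≢ (((_ , Xm) , m≢XY) , ((_ , Ym′) , _)) refl = m≢XY (line-unique X≢Y Xm Ym′ X∈XY Y∈XY)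

      XY≢a : XY ≢ a
      XY≢a = lines-≢ X∈XY (∉a X-off)

      -- XQ avoids the vertices iff Q ≢ AX ∩ a, and XQ ≢ XY iff Q ≢ XY ∩ a.
      Junction-a : Point → Set
      Junction-a Q = ((Inner-a Q × Q ≢ proj-a X-off) × Q ≢ proj-a Y-off) × Q ≢ meet XY a XY≢a

      junction-on-a : ∀ {Q} → Junction-a Q → Q I a
      junction-on-a J = proj₁ (proj₁ (proj₁ (proj₁ (proj₁ J))))

      junction-lines : ∀ {Q} → Junction-a Q → Line × Line
      junction-lines J = join X _ (X≢on-a X-off (junction-on-a J)) , join Y _ (X≢on-a Y-off (junction-on-a J))

      card-meetOn-a : ∀ {r} → HasCard Junction-a r → HasCard (λ mm → LinePair mm × MeetOn a mm) r
      card-meetOn-a h = card-bijection h (λ _ → junction-lines)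
                          (λ _ _ _ → cong₂ _,_ (join-irrelevant _ _) (join-irrelevant _ _)) into injective onto
        where
        XY∩a≢ : ∀ {Q} (Q≢XY∩a : Q ≢ meet XY a XY≢a) (Qa : Q I a) {Z} (Z∈XY : Z I XY) (Z≢Q : Z ≢ Q) →
                join Z Q Z≢Q ≢ XY
        XY∩a≢ Q≢XY∩a Qa Z∈XY Z≢Q e = Q≢XY∩a (sym (meet-unique XY≢a (I-respʳ e (on-joinʳ Z≢Q)) Qa))
        into : ∀ Q (J : Junction-a Q) → LinePair (junction-lines J) × MeetOn a (junction-lines J)
        into Q (((Q-in , Q≢X′) , Q≢Y′) , Q≢XY∩a) =
          (((XQ-off X-off Q-in Q≢X′ , on-joinˡ _) , XY∩a≢ Q≢XY∩a (proj₁ (proj₁ Q-in)) X∈XY _) ,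
           ((XQ-off Y-off Q-in Q≢Y′ , on-joinˡ _) , XY∩a≢ Q≢XY∩a (proj₁ (proj₁ Q-in)) Y∈XY _)) ,
          Q , proj₁ (proj₁ Q-in) , on-joinʳ _ , on-joinʳ _
        injective : ∀ Q Q′ (J : Junction-a Q) (J′ : Junction-a Q′) →
                    junction-lines J ≡ junction-lines J′ → Q ≡ Q′
        injective Q Q′ J J′ e = point-unique (lines-≢ (on-joinˡ _) (∉a X-off)) (on-joinʳ _) (junction-on-a J)
                                             (I-respʳ (sym (cong proj₁ e)) (on-joinʳ _)) (junction-on-a J′)
        onto : ∀ mm → LinePair mm × MeetOn a mm → Σ Point λ Q → Σ (Junction-a Q) λ J → junction-lines J ≡ mm
        onto (m , m′) ((((m-off , Xm) , m≢XY) , ((m′-off , Ym′) , _)) , (P , Pa , Pm , Pm′)) =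
          P , ((X-side , proj₂ Y-side) ,
               λ e → m≢XY (line-unique (X≢on-a X-off Pa) Xm Pm X∈XY (I-respˡ (sym e) (on-meetˡ XY≢a)))) ,
          cong₂ _,_ (join-unique _ Xm Pm) (join-unique _ Ym′ Pm′)
          where
          X-side : Inner-a P × P ≢ proj-a X-off
          X-side = through-meets-a X-off m-off Xm Pa Pm
          Y-side : Inner-a P × P ≢ proj-a Y-off
          Y-side = through-meets-a Y-off m′-off Ym′ Pa Pm′

      proj-a≢proj-a : ¬ A I XY → proj-a Y-off ≢ proj-a X-off
      proj-a≢proj-a A∉XY e = A∉XY (I-respʳ (sym XY≡AX) (on-joinˡ _))
        where
        AX≡AY : join A X (A≢ X-off) ≡ join A Y (A≢ Y-off)
        AX≡AY = line-unique (A≢on-a (on-meetʳ (AX≢a X-off))) (on-joinˡ _) (on-meetˡ (AX≢a X-off))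
                            (on-joinˡ _) (I-respˡ e (on-meetˡ (AX≢a Y-off)))
        XY≡AX : XY ≡ join A X (A≢ X-off)
        XY≡AX = line-unique X≢Y X∈XY Y∈XY (on-joinʳ _) (I-respʳ (sym AX≡AY) (on-joinʳ _))

      card-junction-a-offVertices : OffVertices XY → HasCard Junction-a (1 + k)
      card-junction-a-offVertices XY-off =
        card-remove (card-remove (card-remove card-inner-a (proj-a-inner X-off))
                                 (proj-a-inner Y-off , proj-a≢proj-a (A∉ XY-off)))
                    (((XY∩a-inner , λ e → A∉ XY-off (proj-a-on⇒A-on X-off X∈XY (I-respˡ e (on-meetˡ XY≢a)))) ,
                     λ e → A∉ XY-off (proj-a-on⇒A-on Y-off Y∈XY (I-respˡ e (on-meetˡ XY≢a)))))
        where
        XY∩a-inner : Inner-a (meet XY a XY≢a)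
        XY∩a-inner = (on-meetʳ _ , λ e → B∉ XY-off (I-respˡ e (on-meetˡ _))) , λ e → C∉ XY-off (I-respˡ e (on-meetˡ _))

      card-junction-a-A∈XY : A I XY → HasCard Junction-a (3 + k)
      card-junction-a-A∈XY A∈XY =
        card-⇔ (λ Q (Q-in , Q≢F) → ((Q-in , λ e → Q≢F (trans e (sym (F≡proj-a X-off X∈XY)))) ,
                                    λ e → Q≢F (trans e (sym (F≡proj-a Y-off Y∈XY)))) , Q≢F)
               (λ Q (((Q-in , _) , _) , Q≢F) → Q-in , Q≢F)
               (card-remove card-inner-a F-inner)
        where
        F : Point
        F = meet XY a XY≢a
        F≡proj-a : ∀ {Z} (Z-off : OffSides Z) → Z I XY → F ≡ proj-a Z-off
        F≡proj-a Z-off Z∈XY = meet-unique XY≢a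
          (I-respʳ (line-unique (A≢ Z-off) (on-joinˡ _) (on-joinʳ _) A∈XY Z∈XY) (on-meetˡ _)) (on-meetʳ _)
        F-inner : Inner-a F
        F-inner = (on-meetʳ XY≢a , λ e → ∉c X-off (I-respʳ (AB≡c A∈XY (I-respˡ e (on-meetˡ XY≢a))) X∈XY)) ,
                  λ e → ∉b X-off (I-respʳ (AC≡b A∈XY (I-respˡ e (on-meetˡ XY≢a))) X∈XY)

      card-junction-a-B∨C∈XY : B I XY ⊎ C I XY → HasCard Junction-a (2 + k)
      card-junction-a-B∨C∈XY B∨C∈XY =
        card-⇔ (λ Q J → J , ≢F (proj₁ (proj₁ J))) (λ Q → proj₁)
               (card-remove (card-remove card-inner-a (proj-a-inner X-off)) (proj-a-inner Y-off , proj-a≢proj-a A∉XY))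
        where
        A∉XY : ¬ A I XY
        A∉XY A∈XY = [ (λ B∈XY → ∉c X-off (I-respʳ (AB≡c A∈XY B∈XY) X∈XY)) ,
                      (λ C∈XY → ∉b X-off (I-respʳ (AC≡b A∈XY C∈XY) X∈XY)) ]′ B∨C∈XY
        ≢F : ∀ {Q} → Inner-a Q → Q ≢ meet XY a XY≢a
        ≢F ((_ , Q≢B) , Q≢C) e = [ (λ B∈XY → Q≢B (trans e (meet-unique XY≢a B∈XY Ba))) ,
                                   (λ C∈XY → Q≢C (trans e (meet-unique XY≢a C∈XY Ca))) ]′ B∨C∈XY

      meetOn? : ∀ s → (∀ {ℓ} → OffVertices ℓ → ℓ ≢ s) → ∀ {mm} → LinePair mm → Dec (MeetOn s mm)
      meetOn? s ≢s {m , m′} (((m-off , _) , _) , ((m′-off , _) , _))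
        with ≟-on s (on-meetʳ (≢s m-off)) (on-meetʳ (≢s m′-off))
      ... | yes e  = yes (meet m s (≢s m-off) , on-meetʳ _ , on-meetˡ _ , I-respˡ (sym e) (on-meetˡ _))
      ... | no ne = no λ (P , Ps , Pm , Pm′) → ne (trans (meet-unique _ Pm Ps) (sym (meet-unique _ Pm′ Ps)))

      ¬meetOn-both : ∀ {s s′ V m m′} → LinePair (m , m′) → (∀ {P} → P I s → P I s′ → P ≡ V) → ¬ V I m →
                     MeetOn s (m , m′) → ¬ MeetOn s′ (m , m′)
      ¬meetOn-both mm s∩s′≡V V∉m (P , Ps , Pm , Pm′) (P′ , P′s′ , P′m , P′m′) =
        V∉m (I-respˡ (s∩s′≡V Ps (I-respˡ (sym (point-unique (LinePair⇒≢ mm) Pm Pm′ P′m P′m′)) P′s′)) Pm)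

      CommonOff : Point → Set
      CommonOff Z = OffSides Z × Adjacent X Z × Adjacent Y Z × ¬ Z I XY

      MeetsOffSides : Line × Line → Set
      MeetsOffSides mm = ((LinePair mm × ¬ MeetOn a mm) × ¬ MeetOn b mm) × ¬ MeetOn c mm

      card-commonOff : ∀ {r} → HasCard MeetsOffSides r → HasCard CommonOff r
      card-commonOff h = card-bijection h (λ (m , m′) M → meet m m′ (LinePair⇒≢ (pair M)))
                           (λ _ _ _ → meet-unique _ (on-meetˡ _) (on-meetʳ _)) into injective onto
        where
        pair : ∀ {mm} → MeetsOffSides mm → LinePair mm
        pair M = proj₁ (proj₁ (proj₁ M))
        Z≢X : ∀ {m m′} (M : MeetsOffSides (m , m′)) → meet m m′ (LinePair⇒≢ (pair M)) ≢ X
        Z≢X ((((((_ , Xm) , _) , ((_ , Ym′) , m′≢XY)) , _) , _) , _) e =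
          m′≢XY (line-unique X≢Y (I-respˡ e (on-meetʳ _)) Ym′ X∈XY Y∈XY)
        Z≢Y : ∀ {m m′} (M : MeetsOffSides (m , m′)) → meet m m′ (LinePair⇒≢ (pair M)) ≢ Y
        Z≢Y ((((((_ , Xm) , m≢XY) , _) , _) , _) , _) e =
          m≢XY (line-unique X≢Y Xm (I-respˡ e (on-meetˡ _)) X∈XY Y∈XY)
        into : ∀ mm (M : MeetsOffSides mm) → CommonOff (meet _ _ (LinePair⇒≢ (pair M)))
        into (m , m′) M@((((((m-off , Xm) , m≢XY) , ((m′-off , Ym′) , _)) , ¬a) , ¬b) , ¬c) =
          ((λ Za → ¬a (_ , Za , on-meetˡ _ , on-meetʳ _)) , (λ Zb → ¬b (_ , Zb , on-meetˡ _ , on-meetʳ _)) ,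
           (λ Zc → ¬c (_ , Zc , on-meetˡ _ , on-meetʳ _))) ,
          (≢-sym (Z≢X M) , m , m-off , Xm , on-meetˡ _) ,
          (≢-sym (Z≢Y M) , m′ , m′-off , Ym′ , on-meetʳ _) ,
          λ Z∈XY → m≢XY (line-unique (≢-sym (Z≢X M)) Xm (on-meetˡ _) X∈XY Z∈XY)
        injective : ∀ mm mm′ (M : MeetsOffSides mm) (M′ : MeetsOffSides mm′) →
                    meet _ _ (LinePair⇒≢ (pair M)) ≡ meet _ _ (LinePair⇒≢ (pair M′)) → mm ≡ mm′
        injective _ _ M M′ e = cong₂ _,_
          (line-unique (≢-sym (Z≢X M)) (proj₂ (proj₁ (proj₁ (pair M)))) (on-meetˡ _)
                       (proj₂ (proj₁ (proj₁ (pair M′)))) (I-respˡ (sym e) (on-meetˡ _)))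
          (line-unique (≢-sym (Z≢Y M)) (proj₂ (proj₁ (proj₂ (pair M)))) (on-meetʳ _)
                       (proj₂ (proj₁ (proj₂ (pair M′)))) (I-respˡ (sym e) (on-meetʳ _)))
        onto : ∀ Z → CommonOff Z → Σ (Line × Line) λ mm → Σ (MeetsOffSides mm) λ M →
               meet _ _ (LinePair⇒≢ (pair M)) ≡ Z
        onto Z (Z-off , (_ , m , m-off , Xm , Zm) , (_ , m′ , m′-off , Ym′ , Zm′) , Z∉XY) =
          (m , m′) , (((mm , at-Z ∉a) , at-Z ∉b) , at-Z ∉c) , meet-unique _ Zm Zm′
          where
          mm : LinePair (m , m′)
          mm = ((m-off , Xm) , λ { refl → Z∉XY Zm }) , ((m′-off , Ym′) , λ { refl → Z∉XY Zm′ })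
          at-Z : ∀ {s} → (OffSides Z → ¬ Z I s) → ¬ MeetOn s (m , m′)
          at-Z Z∉ (P , Ps , Pm , Pm′) = Z∉ Z-off (I-respˡ (point-unique (LinePair⇒≢ mm) Pm Pm′ Zm Zm′) Ps)

      -- A pair meets on at most one side: two sides meet in a vertex, which both lines avoid.
      card-commonOff-by-sides : ∀ {t na nb nc} → HasCard LinePair t →
        HasCard (λ mm → LinePair mm × MeetOn a mm) na → HasCard (λ mm → LinePair mm × MeetOn b mm) nb →
        HasCard (λ mm → LinePair mm × MeetOn c mm) nc → Σ ℕ λ r → HasCard CommonOff r × na + (nb + (nc + r)) ≡ t
      card-commonOff-by-sides {t} {na} {nb} {nc} pairs on-a on-b on-c
        with card-partition pairs (meetOn? a ≢a)
      ... | ka , ra , on-a′ , off-a , ka+ra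
        with card-partition off-a (λ (mm , _) → meetOn? b ≢b mm)
      ... | kb , rb , on-b′ , off-ab , kb+rb
        with card-partition off-ab (λ ((mm , _) , _) → meetOn? c ≢c mm)
      ... | kc , r , on-c′ , off-abc , kc+r = r , card-commonOff off-abc , count
        where
        m-off : ∀ {mm} → LinePair mm → OffVertices (proj₁ mm)
        m-off P = proj₁ (proj₁ (proj₁ P))
        on-b″ : HasCard (λ mm → (LinePair mm × ¬ MeetOn a mm) × MeetOn b mm) nb
        on-b″ = card-⇔ (λ _ (P , Mb) → (P , λ Ma → ¬meetOn-both P a∩b≡C (C∉ (m-off P)) Ma Mb) , Mb)
                       (λ _ ((P , _) , Mb) → P , Mb) on-b
        on-c″ : HasCard (λ mm → ((LinePair mm × ¬ MeetOn a mm) × ¬ MeetOn b mm) × MeetOn c mm) nc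
        on-c″ = card-⇔ (λ _ (P , Mc) → ((P , λ Ma → ¬meetOn-both P a∩c≡B (B∉ (m-off P)) Ma Mc) ,
                                         λ Mb → ¬meetOn-both P b∩c≡A (A∉ (m-off P)) Mb Mc) , Mc)
                       (λ _ (((P , _) , _) , Mc) → P , Mc) on-c
        count : na + (nb + (nc + r)) ≡ t
        count = begin
          na + (nb + (nc + r)) ≡⟨ cong₂ _+_ (card-unique on-a on-a′)
                                    (cong₂ _+_ (card-unique on-b″ on-b′) (cong (_+ r) (card-unique on-c″ on-c′))) ⟩
          ka + (kb + (kc + r)) ≡⟨ cong (λ x → ka + (kb + x)) kc+r ⟩
          ka + (kb + rb)       ≡⟨ cong (ka +_) kb+rb ⟩
          ka + ra              ≡⟨ ka+ra ⟩
          t                    ∎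
          where open ≡-Reasoning

    CollinearOn : Point → Line → Point → Set
    CollinearOn P ℓ Q = OffSides Q × Q I ℓ × Σ Line λ m → OffVertices m × P I m × Q I m

    module LineCount (P : Point) (P-off : OffSides P) (ℓ : Line) (ℓ-off : OffVertices ℓ) (P∉ℓ : ¬ P I ℓ) where
      P≢on-ℓ : ∀ {Q} → Q I ℓ → P ≢ Q
      P≢on-ℓ Qℓ refl = P∉ℓ Qℓ

      module Foot (V : Point) (V≢P : V ≢ P) (V∉ℓ : ¬ V I ℓ) where
        PV≢ℓ : join P V (≢-sym V≢P) ≢ ℓ
        PV≢ℓ = lines-≢ (on-joinʳ _) V∉ℓ

        V′ : Point
        V′ = meet (join P V (≢-sym V≢P)) ℓ PV≢ℓ

        V′-on : V′ I ℓ
        V′-on = on-meetʳ PV≢ℓ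

        V′∉side : ∀ {s} → V I s → ¬ P I s → ¬ V′ I s
        V′∉side Vs P∉s V′s =
          V∉ℓ (I-respˡ (point-unique (lines-≢ (on-joinˡ _) P∉s) (on-meetˡ _) V′s (on-joinʳ _) Vs) V′-on)

        ≢V′⇒V∉PQ : ∀ {Q} (Qℓ : Q I ℓ) → Q ≢ V′ → ¬ V I join P Q (P≢on-ℓ Qℓ)
        ≢V′⇒V∉PQ Qℓ Q≢V′ V∈PQ =
          Q≢V′ (sym (meet-unique _ (I-respʳ (line-unique (≢-sym V≢P) (on-joinˡ _) V∈PQ (on-joinˡ _) (on-joinʳ _))
                                            (on-joinʳ _)) Qℓ))

        V∉m⇒≢V′ : ∀ {m Q} → ¬ V I m → P I m → Q I m → Q I ℓ → Q ≢ V′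
        V∉m⇒≢V′ V∉m Pm Qm Qℓ e =
          V∉m (I-respʳ (sym (line-unique (P≢on-ℓ Qℓ) Pm Qm (on-joinˡ _) (I-respˡ (sym e) (on-meetˡ _)))) (on-joinʳ _))

        module _ {s} (VP≢s : join V P V≢P ≢ s) where
          PV≡VP : join P V (≢-sym V≢P) ≡ join V P V≢P
          PV≡VP = line-unique (≢-sym V≢P) (on-joinˡ _) (on-joinʳ _) (on-joinʳ _) (on-joinˡ _)

          proj-on⇒V′-on-side : meet _ s VP≢s I ℓ → V′ I s
          proj-on⇒V′-on-side Prℓ =
            I-respˡ (sym (meet-unique PV≢ℓ (I-respʳ (sym PV≡VP) (on-meetˡ VP≢s)) Prℓ)) (on-meetʳ VP≢s)

          V′-on-side⇒proj-on : V′ I s → meet _ s VP≢s I ℓ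
          V′-on-side⇒proj-on V′s = I-respˡ (sym (meet-unique VP≢s (I-respʳ PV≡VP (on-meetˡ _)) V′s)) V′-on

      feet-≢ : ∀ {V W s} V≢P W≢P V∉ℓ W∉ℓ → V I s → W I s → V ≢ W → ¬ P I s →
               Foot.V′ V V≢P V∉ℓ ≢ Foot.V′ W W≢P W∉ℓ
      feet-≢ V≢P W≢P V∉ℓ W∉ℓ Vs Ws V≢W P∉s e =
        P∉s (I-respʳ (line-unique V≢W (on-joinʳ _) (I-respʳ (sym PV≡PW) (on-joinʳ _)) Vs Ws) (on-joinˡ _))
        where
        PV≡PW : join P _ (≢-sym V≢P) ≡ join P _ (≢-sym W≢P)
        PV≡PW = line-unique (P≢on-ℓ (Foot.V′-on _ V≢P V∉ℓ)) (on-joinˡ _) (on-meetˡ _)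
                            (on-joinˡ _) (I-respˡ (sym e) (on-meetˡ _))

      module A′ = Foot A (A≢ P-off) (A∉ ℓ-off)
      module B′ = Foot B (B≢ P-off) (B∉ ℓ-off)
      module C′ = Foot C (C≢ P-off) (C∉ ℓ-off)

      Good : Point → Set
      Good Q = OffSides Q × Q I ℓ

      A′-good? : Dec (A′.V′ I a) → Dec (Good A′.V′)
      A′-good? (yes A′a) = no λ (off , _) → ∉a off A′a
      A′-good? (no A′∉a) = yes ((A′∉a , A′.V′∉side Ab (∉b P-off) , A′.V′∉side Ac (∉c P-off)) , A′.V′-on)

      B′-good? : Dec (B′.V′ I b) → Dec (Good B′.V′ × B′.V′ ≢ A′.V′)
      B′-good? (yes B′b) = no λ ((off , _) , _) → ∉b off B′b
      B′-good? (no B′∉b) = yes (((B′.V′∉side Ba (∉a P-off) , B′∉b , B′.V′∉side Bc (∉c P-off)) , B′.V′-on) ,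
                                feet-≢ (B≢ P-off) (A≢ P-off) (B∉ ℓ-off) (A∉ ℓ-off) Bc Ac (≢-sym A≢B) (∉c P-off))

      C′-good? : Dec (C′.V′ I c) → Dec ((Good C′.V′ × C′.V′ ≢ A′.V′) × C′.V′ ≢ B′.V′)
      C′-good? (yes C′c) = no λ (((off , _) , _) , _) → ∉c off C′c
      C′-good? (no C′∉c) = yes ((((C′.V′∉side Ca (∉a P-off) , C′.V′∉side Cb (∉b P-off) , C′∉c) , C′.V′-on) ,
                                 feet-≢ (C≢ P-off) (A≢ P-off) (C∉ ℓ-off) (A∉ ℓ-off) Cb Ab (≢-sym A≢C) (∉b P-off)) ,
                                feet-≢ (C≢ P-off) (B≢ P-off) (C∉ ℓ-off) (B∉ ℓ-off) Ca Ba (≢-sym B≢C) (∉a P-off))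

      -- Q ∈ ℓ is seen from P along a line avoiding the vertices iff Q is none of the three feet.
      card-collinearOn : (A′a? : Dec (A′.V′ I a)) (B′b? : Dec (B′.V′ I b)) (C′c? : Dec (C′.V′ I c)) →
        HasCard (CollinearOn P ℓ) (pred-if (C′-good? C′c?) (pred-if (B′-good? B′b?) (pred-if (A′-good? A′a?) (3 + k))))
      card-collinearOn A′a? B′b? C′c? =
        card-⇔ to from
          (card-remove? (card-remove? (card-remove? (card-offSides-on ℓ ℓ-off) (A′-good? A′a?)) (B′-good? B′b?))
                        (C′-good? C′c?))
        where
        to : ∀ Q → ((Good Q × Q ≢ A′.V′) × Q ≢ B′.V′) × Q ≢ C′.V′ → CollinearOn P ℓ Q
        to Q ((((Q-off , Qℓ) , ≢A′) , ≢B′) , ≢C′) =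
          Q-off , Qℓ , join P Q (P≢on-ℓ Qℓ) ,
          (A′.≢V′⇒V∉PQ Qℓ ≢A′ , B′.≢V′⇒V∉PQ Qℓ ≢B′ , C′.≢V′⇒V∉PQ Qℓ ≢C′) , on-joinˡ _ , on-joinʳ _
        from : ∀ Q → CollinearOn P ℓ Q → ((Good Q × Q ≢ A′.V′) × Q ≢ B′.V′) × Q ≢ C′.V′
        from Q (Q-off , Qℓ , m , m-off , Pm , Qm) =
          (((Q-off , Qℓ) , A′.V∉m⇒≢V′ (A∉ m-off) Pm Qm Qℓ) , B′.V∉m⇒≢V′ (B∉ m-off) Pm Qm Qℓ) ,
          C′.V∉m⇒≢V′ (C∉ m-off) Pm Qm Qℓ

    -- ℓ₁ passes through V only, ℓ₂ through none of V, W, U, and ℓ₃ through V and W.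
    module Witnesses (P : Point) (P-off : OffSides P) where
      V W U : Point
      V = proj-a P-off
      W = proj-b P-off
      U = proj-c P-off

      Va : V I a
      Va = proj₁ (proj₁ (proj-a-inner P-off))
      Wb : W I b
      Wb = proj₁ (proj₁ (proj-b-inner P-off))
      Uc : U I c
      Uc = proj₁ (proj₁ (proj-c-inner P-off))
      V≢B : V ≢ B
      V≢B = proj₂ (proj₁ (proj-a-inner P-off))
      W≢A : W ≢ A
      W≢A = proj₂ (proj₁ (proj-b-inner P-off))
      V∉b : ¬ V I b
      V∉b Vb = proj₂ (proj-a-inner P-off) (a∩b≡C Va Vb)
      V∈AP : V I join A P (A≢ P-off)
      V∈AP = on-meetˡ (AX≢a P-off)
      W∈BP : W I join B P (B≢ P-off)
      W∈BP = on-meetˡ (BX≢b P-off)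

      module Line₁ where
        V≢U : V ≢ U
        V≢U e = V≢B (a∩c≡B Va (I-respˡ (sym e) Uc))
        VU≢b : join V U V≢U ≢ b
        VU≢b = lines-≢ (on-joinˡ V≢U) V∉b
        R₀ : Point
        R₀ = meet (join V U V≢U) b VU≢b

        R-choice : Σ Point λ R → R I b × R ∉ A ∷ C ∷ W ∷ R₀ ∷ []
        R-choice = avoid-on b (A ∷ C ∷ W ∷ R₀ ∷ []) (Ab ∷ Cb ∷ Wb ∷ on-meetʳ VU≢b ∷ []) (m≤m+n _ _)
        R : Point
        R = proj₁ R-choice
        Rb : R I b
        Rb = proj₁ (proj₂ R-choice)
        R∉ : R ∉ A ∷ C ∷ W ∷ R₀ ∷ []
        R∉ = proj₂ (proj₂ R-choice)
        V≢R : V ≢ R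
        V≢R e = V∉b (I-respˡ (sym e) Rb)

        ℓ₁ : Line
        ℓ₁ = join V R V≢R
        ℓ₁-off : OffVertices ℓ₁
        ℓ₁-off = (λ A∈ → V∉b (I-respʳ (line-unique (λ e → R∉ (here e)) (on-joinʳ _) A∈ Rb Ab) (on-joinˡ _))) ,
                 (λ B∈ → R∉ (there (here (a∩b≡C (I-respʳ (line-unique V≢B (on-joinˡ _) B∈ Va Ba) (on-joinʳ _)) Rb)))) ,
                 (λ C∈ → V∉b (I-respʳ (line-unique (λ e → R∉ (there (here e))) (on-joinʳ _) C∈ Rb Cb) (on-joinˡ _)))
        P∉ℓ₁ : ¬ P I ℓ₁
        P∉ℓ₁ P∈ = A∉ ℓ₁-off (proj-a-on⇒A-on P-off P∈ (on-joinˡ _))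

        open LineCount P P-off ℓ₁ ℓ₁-off P∉ℓ₁

        count : HasCard (CollinearOn P ℓ₁) (1 + k)
        count = card-collinearOn (yes (A′.proj-on⇒V′-on-side (AX≢a P-off) (on-joinˡ _))) (no B′∉b) (no C′∉c)
          where
          B′∉b : ¬ B′.V′ I b
          B′∉b B′b = R∉ (there (there (here (point-unique (lines-≢ (on-joinˡ _) V∉b) (on-joinʳ _) Rb
                                                          (B′.V′-on-side⇒proj-on (BX≢b P-off) B′b) Wb))))
          C′∉c : ¬ C′.V′ I c
          C′∉c C′c = R∉ (there (there (there (here (sym (meet-unique VU≢b
                       (I-respʳ (line-unique V≢U (on-joinˡ _) (C′.V′-on-side⇒proj-on (CX≢c P-off) C′c)
                                             (on-joinˡ _) (on-joinʳ _)) (on-joinʳ _)) Rb))))))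

      module Line₂ where
        X₀-choice : Σ Point λ X₀ → X₀ I c × X₀ ∉ A ∷ B ∷ U ∷ []
        X₀-choice = avoid-on c (A ∷ B ∷ U ∷ []) (Ac ∷ Bc ∷ Uc ∷ []) (m≤m+n _ _)
        X₀ : Point
        X₀ = proj₁ X₀-choice
        X₀c : X₀ I c
        X₀c = proj₁ (proj₂ X₀-choice)
        X₀∉ : X₀ ∉ A ∷ B ∷ U ∷ []
        X₀∉ = proj₂ (proj₂ X₀-choice)
        X₀≢A : X₀ ≢ A
        X₀≢A e = X₀∉ (here e)
        X₀≢B : X₀ ≢ B
        X₀≢B e = X₀∉ (there (here e))
        X₀∉a : ¬ X₀ I a
        X₀∉a X₀a = X₀≢B (a∩c≡B X₀a X₀c)
        X₀≢P : X₀ ≢ P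
        X₀≢P e = ∉c P-off (I-respˡ e X₀c)
        X₀≢W : X₀ ≢ W
        X₀≢W e = X₀≢A (b∩c≡A (I-respˡ (sym e) Wb) X₀c)
        X₀P∩a X₀W∩a : Point
        X₀P∩a = meet (join X₀ P X₀≢P) a (lines-≢ (on-joinˡ _) X₀∉a)
        X₀W∩a = meet (join X₀ W X₀≢W) a (lines-≢ (on-joinˡ _) X₀∉a)

        S-choice : Σ Point λ S → S I a × S ∉ B ∷ C ∷ V ∷ X₀P∩a ∷ X₀W∩a ∷ []
        S-choice = avoid-on a (B ∷ C ∷ V ∷ X₀P∩a ∷ X₀W∩a ∷ [])
                              (Ba ∷ Ca ∷ Va ∷ on-meetʳ _ ∷ on-meetʳ _ ∷ []) (m≤m+n _ _)
        S : Point
        S = proj₁ S-choice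
        Sa : S I a
        Sa = proj₁ (proj₂ S-choice)
        S∉ : S ∉ B ∷ C ∷ V ∷ X₀P∩a ∷ X₀W∩a ∷ []
        S∉ = proj₂ (proj₂ S-choice)
        S≢B : S ≢ B
        S≢B e = S∉ (here e)
        X₀≢S : X₀ ≢ S
        X₀≢S e = X₀∉a (I-respˡ (sym e) Sa)

        ℓ₂ : Line
        ℓ₂ = join X₀ S X₀≢S
        ℓ₂≢a : ℓ₂ ≢ a
        ℓ₂≢a = lines-≢ (on-joinˡ _) X₀∉a
        ℓ₂-off : OffVertices ℓ₂
        ℓ₂-off = (λ A∈ → S≢B (a∩c≡B Sa (I-respʳ (line-unique (≢-sym X₀≢A) A∈ (on-joinˡ _) Ac X₀c) (on-joinʳ _)))) ,
                 (λ B∈ → S≢B (a∩c≡B Sa (I-respʳ (line-unique (≢-sym X₀≢B) B∈ (on-joinˡ _) Bc X₀c) (on-joinʳ _)))) ,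
                 (λ C∈ → X₀∉a (I-respʳ (line-unique (λ e → S∉ (there (here e))) (on-joinʳ _) C∈ Sa Ca) (on-joinˡ _)))
        P∉ℓ₂ : ¬ P I ℓ₂
        P∉ℓ₂ P∈ = S∉ (there (there (there (here (sym (meet-unique _
                    (I-respʳ (line-unique X₀≢P (on-joinˡ _) P∈ (on-joinˡ _) (on-joinʳ _)) (on-joinʳ _)) Sa))))))

        open LineCount P P-off ℓ₂ ℓ₂-off P∉ℓ₂

        count : HasCard (CollinearOn P ℓ₂) k
        count = card-collinearOn (no A′∉a) (no B′∉b) (no C′∉c)
          where
          A′∉a : ¬ A′.V′ I a
          A′∉a A′a = S∉ (there (there (here (point-unique ℓ₂≢a (on-joinʳ _) Sa
                                                            (A′.V′-on-side⇒proj-on (AX≢a P-off) A′a) Va))))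
          B′∉b : ¬ B′.V′ I b
          B′∉b B′b = S∉ (there (there (there (there (here (sym (meet-unique _
                       (I-respʳ (line-unique X₀≢W (on-joinˡ _) (B′.V′-on-side⇒proj-on (BX≢b P-off) B′b)
                                             (on-joinˡ _) (on-joinʳ _)) (on-joinʳ _)) Sa)))))))
          C′∉c : ¬ C′.V′ I c
          C′∉c C′c = X₀∉ (there (there (here (point-unique (lines-≢ (on-joinʳ _) λ Sc → S≢B (a∩c≡B Sa Sc))
                         (on-joinˡ _) X₀c (C′.V′-on-side⇒proj-on (CX≢c P-off) C′c) Uc))))

      module Line₃ where
        V≢W : V ≢ W
        V≢W e = V∉b (I-respˡ (sym e) Wb)

        ℓ₃ : Line
        ℓ₃ = join V W V≢W
        ℓ₃-off : OffVertices ℓ₃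
        ℓ₃-off =
          (λ A∈ → ∉b P-off (I-respʳ (line-unique (≢-sym W≢A) (on-joinˡ _)
                    (I-respʳ (line-unique (≢-sym (A≢on-a Va)) (on-joinˡ _) A∈ V∈AP (on-joinˡ _)) (on-joinʳ _)) Ab Wb) (on-joinʳ _))) ,
          (λ B∈ → ∉a P-off (I-respʳ (line-unique (≢-sym V≢B) (on-joinˡ _)
                    (I-respʳ (line-unique (≢-sym (B≢on-b Wb)) (on-joinʳ _) B∈ W∈BP (on-joinˡ _)) (on-joinˡ _)) Ba Va) (on-joinʳ _))) ,
          (λ C∈ → proj₂ (proj-b-inner P-off)
                    (a∩b≡C (I-respʳ (line-unique (≢-sym (proj₂ (proj-a-inner P-off))) C∈ (on-joinˡ _) Ca Va) (on-joinʳ _)) Wb))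
        P∉ℓ₃ : ¬ P I ℓ₃
        P∉ℓ₃ P∈ = A∉ ℓ₃-off (proj-a-on⇒A-on P-off P∈ (on-joinˡ _))

        open LineCount P P-off ℓ₃ ℓ₃-off P∉ℓ₃

        A′a : A′.V′ I a
        A′a = A′.proj-on⇒V′-on-side (AX≢a P-off) (on-joinˡ _)
        B′b : B′.V′ I b
        B′b = B′.proj-on⇒V′-on-side (BX≢b P-off) (on-joinʳ _)

        count : Σ ℕ λ r → HasCard (CollinearOn P ℓ₃) r × (r ≡ 3 + k ⊎ r ≡ 2 + k)
        count with ≟-on ℓ₃ C′.V′-on (on-meetˡ (≢c ℓ₃-off))
        ... | yes C′≡ℓ₃∩c =
          _ , card-collinearOn (yes A′a) (yes B′b) (yes (I-respˡ (sym C′≡ℓ₃∩c) (on-meetʳ _))) , inj₁ refl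
        ... | no C′≢ℓ₃∩c =
          _ , card-collinearOn (yes A′a) (yes B′b) (no λ C′c → C′≢ℓ₃∩c (sym (meet-unique _ C′.V′-on C′c))) , inj₂ refl

    not-αβ : ∀ P → OffSides P → ∀ α β →
             ¬ (∀ ℓ → OffVertices ℓ → ¬ P I ℓ → HasCard (CollinearOn P ℓ) α ⊎ HasCard (CollinearOn P ℓ) β)
    not-αβ P P-off α β αβ =
      let r , card₃ , r≡ = Line₃.count
          k≢r , 1+k≢r = k,1+k≢ r≡
      in no-three-distinct-in-pair (m≢1+n+m k {0}) k≢r 1+k≢r
           (count-value Line₂.count (αβ _ Line₂.ℓ₂-off Line₂.P∉ℓ₂))
           (count-value Line₁.count (αβ _ Line₁.ℓ₁-off Line₁.P∉ℓ₁))
           (count-value card₃ (αβ _ Line₃.ℓ₃-off Line₃.P∉ℓ₃))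
      where
      open Witnesses P P-off
      count-value : ∀ {ℓ r} → HasCard (CollinearOn P ℓ) r →
                    HasCard (CollinearOn P ℓ) α ⊎ HasCard (CollinearOn P ℓ) β → r ≡ α ⊎ r ≡ β
      count-value h = map-⊎ (card-unique h) (card-unique h)
      k,1+k≢ : ∀ {r} → r ≡ 3 + k ⊎ r ≡ 2 + k → k ≢ r × suc k ≢ r
      k,1+k≢ (inj₁ refl) = m≢1+n+m k {2} , m≢1+n+m (suc k) {1}
      k,1+k≢ (inj₂ refl) = m≢1+n+m k {1} , m≢1+n+m (suc k) {0}

  rotate-offSides : ∀ T {X} → Sides.OffSides T X → Sides.OffSides (rotate T) X
  rotate-offSides _ (X∉a , X∉b , X∉c) = X∉b , X∉c , X∉a

  rotate-offVertices : ∀ T {ℓ} → Sides.OffVertices T ℓ → Sides.OffVertices (rotate T) ℓ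
  rotate-offVertices _ (A∉ℓ , B∉ℓ , C∉ℓ) = B∉ℓ , C∉ℓ , A∉ℓ

  module CommonCount (T : Triangle) (X Y : Point) (X-off : Sides.OffSides T X) (Y-off : Sides.OffSides T Y)
                     (X≢Y : X ≢ Y) where
    open Sides T
    open CommonNeighbours X Y X-off Y-off X≢Y
    module N₁ = Sides.CommonNeighbours (rotate T) X Y (rotate-offSides T X-off) (rotate-offSides T Y-off) X≢Y
    module N₂ = Sides.CommonNeighbours (rotate (rotate T)) X Y
                  (rotate-offSides (rotate T) (rotate-offSides T X-off)) (rotate-offSides (rotate T) (rotate-offSides T Y-off)) X≢Y

    -- Pairs meeting on b (on c) are counted as pairs meeting on the first side of rotate T (rotate (rotate T)).
    unrotate-pairs₁ : ∀ {r} → HasCard (λ mm → N₁.LinePair mm × MeetOn b mm) r →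
                      HasCard (λ mm → LinePair mm × MeetOn b mm) r
    unrotate-pairs₁ = card-⇔
      (λ _ (((((B∉m , C∉m , A∉m) , Xm) , m≢XY) , (((B∉m′ , C∉m′ , A∉m′) , Ym′) , m′≢XY)) , M) →
         ((((A∉m , B∉m , C∉m) , Xm) , m≢XY) , (((A∉m′ , B∉m′ , C∉m′) , Ym′) , m′≢XY)) , M)
      (λ _ (((((A∉m , B∉m , C∉m) , Xm) , m≢XY) , (((A∉m′ , B∉m′ , C∉m′) , Ym′) , m′≢XY)) , M) →
         ((((B∉m , C∉m , A∉m) , Xm) , m≢XY) , (((B∉m′ , C∉m′ , A∉m′) , Ym′) , m′≢XY)) , M)

    unrotate-pairs₂ : ∀ {r} → HasCard (λ mm → N₂.LinePair mm × MeetOn c mm) r →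
                      HasCard (λ mm → LinePair mm × MeetOn c mm) r
    unrotate-pairs₂ = card-⇔
      (λ _ (((((C∉m , A∉m , B∉m) , Xm) , m≢XY) , (((C∉m′ , A∉m′ , B∉m′) , Ym′) , m′≢XY)) , M) →
         ((((A∉m , B∉m , C∉m) , Xm) , m≢XY) , (((A∉m′ , B∉m′ , C∉m′) , Ym′) , m′≢XY)) , M)
      (λ _ (((((A∉m , B∉m , C∉m) , Xm) , m≢XY) , (((A∉m′ , B∉m′ , C∉m′) , Ym′) , m′≢XY)) , M) →
         ((((C∉m , A∉m , B∉m) , Xm) , m≢XY) , (((C∉m′ , A∉m′ , B∉m′) , Ym′) , m′≢XY)) , M)

    card-common-adjacent : Adjacent X Y → HasCard (λ Z → OffSides Z × Adjacent X Z × Adjacent Y Z) ((1 + k) ^ 2 + 1)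
    card-common-adjacent (_ , ℓ , ℓ-off , Xℓ , Yℓ) =
      let r , card-off , total = card-commonOff-by-sides pairs
            (card-meetOn-a (card-junction-a-offVertices XY-off))
            (unrotate-pairs₁ (N₁.card-meetOn-a (N₁.card-junction-a-offVertices (rotate-offVertices T XY-off))))
            (unrotate-pairs₂ (N₂.card-meetOn-a
              (N₂.card-junction-a-offVertices (rotate-offVertices (rotate T) (rotate-offVertices T XY-off)))))
      in subst (HasCard _) (trans (cong ((1 + k) +_) (cancel-three {1 + k} {1 + k} {1 + k} total (λ-square k))) (λ-total k))
               (card-⇔ to from (card-⊎ on-XY card-off λ { _ (((_ , Z∈XY) , _) , _) (_ , _ , _ , Z∉XY) → Z∉XY Z∈XY }))
      where
      XY-off : OffVertices XY
      XY-off = subst OffVertices (sym (join-unique X≢Y Xℓ Yℓ)) ℓ-off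
      pairs : HasCard LinePair ((2 + k) * (2 + k))
      pairs = card-Σ (card-remove (card-offVertices-through X-off) (XY-off , X∈XY))
                     (λ _ _ → card-remove (card-offVertices-through Y-off) (XY-off , Y∈XY))
      on-XY : HasCard (λ Z → ((OffSides Z × Z I XY) × Z ≢ X) × Z ≢ Y) (1 + k)
      on-XY = card-remove (card-remove (card-offSides-on XY XY-off) (X-off , X∈XY)) ((Y-off , Y∈XY) , ≢-sym X≢Y)
      to : ∀ Z → ((OffSides Z × Z I XY) × Z ≢ X) × Z ≢ Y ⊎ CommonOff Z → OffSides Z × Adjacent X Z × Adjacent Y Z
      to Z (inj₁ (((Z-off , Z∈XY) , Z≢X) , Z≢Y)) =
        Z-off , (≢-sym Z≢X , XY , XY-off , X∈XY , Z∈XY) , (≢-sym Z≢Y , XY , XY-off , Y∈XY , Z∈XY)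
      to Z (inj₂ (Z-off , X~Z , Y~Z , _)) = Z-off , X~Z , Y~Z
      from : ∀ Z → OffSides Z × Adjacent X Z × Adjacent Y Z → ((OffSides Z × Z I XY) × Z ≢ X) × Z ≢ Y ⊎ CommonOff Z
      from Z (Z-off , X~Z@(X≢Z , m , _ , Xm , Zm) , Y~Z@(Y≢Z , _))
        with ≟-through (∉a X-off) Xm X∈XY
      ... | yes refl = inj₁ (((Z-off , Zm) , ≢-sym X≢Z) , ≢-sym Y≢Z)
      ... | no m≢XY  = inj₂ (Z-off , X~Z , Y~Z , λ Z∈XY → m≢XY (line-unique X≢Z Xm Zm X∈XY Z∈XY))

    module NonAdjacent (X≁Y : ¬ Adjacent X Y) where
      XY-not-off : ¬ OffVertices XY
      XY-not-off XY-off = X≁Y (X≢Y , XY , XY-off , X∈XY , Y∈XY)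

      pairs : HasCard LinePair ((3 + k) * (3 + k))
      pairs = card-Σ (away-from-XY (card-offVertices-through X-off)) (λ _ _ → away-from-XY (card-offVertices-through Y-off))
        where
        away-from-XY : ∀ {Z r} → HasCard (λ m → OffVertices m × Z I m) r →
                       HasCard (λ m → (OffVertices m × Z I m) × m ≢ XY) r
        away-from-XY = card-⇔ (λ _ M → M , λ { refl → XY-not-off (proj₁ M) }) (λ _ → proj₁)

      vertex-on-XY? : ∀ {V} → V ≢ X → Dec (V I XY)
      vertex-on-XY? V≢X with ≟-through (∉a X-off) X∈XY (on-joinʳ V≢X)
      ... | yes XY≡VX = yes (I-respʳ (sym XY≡VX) (on-joinˡ _))
      ... | no XY≢VX  = no λ V∈XY → XY≢VX (line-unique (≢-sym V≢X) X∈XY V∈XY (on-joinʳ _) (on-joinˡ _))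

      from-junctions : ∀ {x y z} → HasCard Junction-a x → HasCard N₁.Junction-a y → HasCard N₂.Junction-a z →
                       (3 + k) * (3 + k) ≡ x + (y + (z + (2 + k) * (1 + k))) → HasCard CommonOff ((2 + k) * (1 + k))
      from-junctions {x} {y} {z} on-a on-b on-c square =
        let r , card-off , total = card-commonOff-by-sides pairs (card-meetOn-a on-a)
                                     (unrotate-pairs₁ (N₁.card-meetOn-a on-b)) (unrotate-pairs₂ (N₂.card-meetOn-a on-c))
        in subst (HasCard CommonOff) (cancel-three {x} {y} {z} total square) card-off

      common-off : HasCard CommonOff ((2 + k) * (1 + k))
      common-off with vertex-on-XY? (A≢ X-off) | vertex-on-XY? (B≢ X-off) | vertex-on-XY? (C≢ X-off)
      ... | yes A∈XY | _        | _        =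
        from-junctions (card-junction-a-A∈XY A∈XY) (N₁.card-junction-a-B∨C∈XY (inj₂ A∈XY))
                       (N₂.card-junction-a-B∨C∈XY (inj₁ A∈XY)) (μ-square₁ k)
      ... | no _     | yes B∈XY | _        =
        from-junctions (card-junction-a-B∨C∈XY (inj₁ B∈XY)) (N₁.card-junction-a-A∈XY B∈XY)
                       (N₂.card-junction-a-B∨C∈XY (inj₂ B∈XY)) (μ-square₂ k)
      ... | no _     | no _     | yes C∈XY =
        from-junctions (card-junction-a-B∨C∈XY (inj₂ C∈XY)) (N₁.card-junction-a-B∨C∈XY (inj₁ C∈XY))
                       (N₂.card-junction-a-A∈XY C∈XY) (μ-square₃ k)
      ... | no A∉XY  | no B∉XY  | no C∉XY  = ⊥-elim (XY-not-off (A∉XY , B∉XY , C∉XY))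

    card-common-nonadjacent : ¬ Adjacent X Y →
                              HasCard (λ Z → OffSides Z × Adjacent X Z × Adjacent Y Z) ((2 + k) * (1 + k))
    card-common-nonadjacent X≁Y =
      card-⇔ (λ _ (Z-off , X~Z , Y~Z , _) → Z-off , X~Z , Y~Z)
             (λ _ (Z-off , X~Z@(X≢Z , m , m-off , Xm , Zm) , Y~Z) →
                Z-off , X~Z , Y~Z , λ Z∈XY → XY-not-off (subst OffVertices (line-unique X≢Z Xm Zm X∈XY Z∈XY) m-off))
             common-off
      where open NonAdjacent X≁Y

module DeletedTriangle {k : ℕ} (𝒫 : IncStr) (pp : IsProjectivePlane 𝒫 (5 + k))
                       (A B C : IncStr.Point 𝒫) (ABC : ¬ Collinear₃ 𝒫 A B C) where
  open Triangles 𝒫 pp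
  open IsProjectivePlane pp using (lineThrough; nondegenerate)

  ¬¬collinear : ∀ P Q → ¬ ¬ Collinear 𝒫 P Q
  ¬¬collinear P Q ¬PQ with nondegenerate
  ... | X₁ , X₂ , _ , _ , X₁≢X₂ , _ = line-through-P {X₁} λ { refl → line-through-P X₁≢X₂ }
    where
    line-through-P : ∀ {X} → P ≢ X → ⊥
    line-through-P P≢X =
      let ℓ , Pℓ , _ = lineThrough _ _ P≢X
      in ¬PQ (lineThrough P Q λ { refl → ¬PQ (ℓ , Pℓ , Pℓ) })

  A≢B : A ≢ B
  A≢B refl = ¬¬collinear A C λ (ℓ , Aℓ , Cℓ) → ABC (ℓ , Aℓ , Aℓ , Cℓ)
  A≢C : A ≢ C
  A≢C refl = ¬¬collinear A B λ (ℓ , Aℓ , Bℓ) → ABC (ℓ , Aℓ , Bℓ , Aℓ)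
  B≢C : B ≢ C
  B≢C refl = ¬¬collinear A B λ (ℓ , Aℓ , Bℓ) → ABC (ℓ , Aℓ , Bℓ , Bℓ)

  T : Triangle
  T = record
    { A = A ; B = B ; C = C ; a = join B C B≢C ; b = join A C A≢C ; c = join A B A≢B
    ; Ba = on-joinˡ _ ; Ca = on-joinʳ _ ; Ab = on-joinˡ _ ; Cb = on-joinʳ _ ; Ac = on-joinˡ _ ; Bc = on-joinʳ _
    ; A∉a = λ A∈ → ABC (_ , A∈ , on-joinˡ _ , on-joinʳ _)
    ; B∉b = λ B∈ → ABC (_ , on-joinˡ _ , B∈ , on-joinʳ _)
    ; C∉c = λ C∈ → ABC (_ , on-joinˡ _ , on-joinʳ _ , C∈) }

  open Sides T hiding (A; B; C; A≢B; A≢C; B≢C)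

  Kept : Point → Set
  Kept X = ¬ Collinear₃ 𝒫 A B X × ¬ Collinear₃ 𝒫 A C X × ¬ Collinear₃ 𝒫 B C X

  offSides⇒kept : ∀ {X} → OffSides X → Kept X
  offSides⇒kept (X∉a , X∉b , X∉c) =
    (λ (ℓ , Aℓ , Bℓ , Xℓ) → X∉c (I-respʳ (AB≡c Aℓ Bℓ) Xℓ)) ,
    (λ (ℓ , Aℓ , Cℓ , Xℓ) → X∉b (I-respʳ (AC≡b Aℓ Cℓ) Xℓ)) ,
    (λ (ℓ , Bℓ , Cℓ , Xℓ) → X∉a (I-respʳ (BC≡a Bℓ Cℓ) Xℓ))

  kept⇒offSides : ∀ {X} → Kept X → OffSides X
  kept⇒offSides (¬ABX , ¬ACX , ¬BCX) = (λ Xa → ¬BCX (_ , Ba , Ca , Xa)) , (λ Xb → ¬ACX (_ , Ab , Cb , Xb)) ,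
                                        (λ Xc → ¬ABX (_ , Ac , Bc , Xc))

  𝒟 : IncStr
  𝒟 = deleteTriangle 𝒫 A B C
  open IncStr 𝒟 using () renaming (Point to Point′; Line to Line′)

  point-offSides : (X : Point′) → OffSides (value X)
  point-offSides (_ , [ p ]) =
    kept⇒offSides (irrelevant-¬ (proj₁ p) , irrelevant-¬ (proj₁ (proj₂ p)) , irrelevant-¬ (proj₂ (proj₂ p)))

  line-offVertices : (ℓ : Line′) → OffVertices (value ℓ)
  line-offVertices (_ , [ p ]) = irrelevant-¬ (proj₁ p) , irrelevant-¬ (proj₁ (proj₂ p)) , irrelevant-¬ (proj₂ (proj₂ p))

  card-points : ∀ {R : Point → Set} {m} → HasCard (λ X → OffSides X × R X) m → HasCard {Point′} (λ X → R (value X)) m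
  card-points h = card-refine (λ X → offSides⇒kept (point-offSides X))
                    (card-⇔ (λ _ (X-off , RX) → offSides⇒kept X-off , RX) (λ _ (X-kept , RX) → kept⇒offSides X-kept , RX) h)

  card-lines : ∀ {R : Line → Set} {m} → HasCard (λ ℓ → OffVertices ℓ × R ℓ) m →
               HasCard {Line′} (λ ℓ → R (value ℓ)) m
  card-lines = card-refine line-offVertices

  adjacent⇒pointAdj : ∀ {X Z : Point′} → Adjacent (value X) (value Z) → PointAdj 𝒟 X Z
  adjacent⇒pointAdj (X≢Z , ℓ , ℓ-off , Xℓ , Zℓ) = (λ { refl → X≢Z refl }) , refine ℓ ℓ-off , Xℓ , Zℓ

  pointAdj⇒adjacent : ∀ {X Z : Point′} → PointAdj 𝒟 X Z → Adjacent (value X) (value Z)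
  pointAdj⇒adjacent (X≢Z , ℓ , Xℓ , Zℓ) = (λ e → X≢Z (value-injective e)) , value ℓ , line-offVertices ℓ , Xℓ , Zℓ

  card-common : ∀ {X Y : Point′} {m} →
                HasCard (λ Z → OffSides Z × Adjacent (value X) Z × Adjacent (value Y) Z) m →
                HasCard (λ Z → PointAdj 𝒟 X Z × PointAdj 𝒟 Y Z) m
  card-common h = card-⇔ (λ _ (X~Z , Y~Z) → adjacent⇒pointAdj X~Z , adjacent⇒pointAdj Y~Z)
                         (λ _ (X~Z , Y~Z) → pointAdj⇒adjacent X~Z , pointAdj⇒adjacent Y~Z) (card-points h)

  square : (4 + k) * (4 + k) ≡ (4 + k) ^ 2
  square = cong ((4 + k) *_) (sym (*-identityʳ (4 + k)))

  configuration : IsConfiguration 𝒟 ((4 + k) ^ 2) (3 + k)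
  configuration = record
    { points       = subst (HasSize Point′) square
                       (card-points (card-⇔ (λ _ X-off → X-off , tt) (λ _ → proj₁) card-offSides))
    ; lines        = subst (HasSize Line′) square
                       (card-lines (card-⇔ (λ _ ℓ-off → ℓ-off , tt) (λ _ → proj₁) card-offVertices))
    ; pointsOnLine = λ ℓ → card-points (card-offSides-on (value ℓ) (line-offVertices ℓ))
    ; linesOnPoint = λ X → card-lines (card-offVertices-through (point-offSides X))
    ; atMostOne    = λ _ _ _ _ X≢Y Xℓ Yℓ Xm Ym →
                       value-injective (line-unique (λ e → X≢Y (value-injective e)) Xℓ Yℓ Xm Ym)
    }

  strongly-regular : IsSRG (pointGraph 𝒟) ((4 + k) ^ 2) ((3 + k) * (2 + k)) ((1 + k) ^ 2 + 1) ((2 + k) * (1 + k))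
  strongly-regular = record
    { size    = IsConfiguration.points configuration
    ; regular = λ X → card-⇔ (λ _ → adjacent⇒pointAdj) (λ _ → pointAdj⇒adjacent)
                             (card-points (card-adjacent (value X) (point-offSides X)))
    ; lambda  = λ X Y X≢Y X~Y → card-common (CommonCount.card-common-adjacent T (value X) (value Y)
                  (point-offSides X) (point-offSides Y) (λ e → X≢Y (value-injective e)) (pointAdj⇒adjacent X~Y))
    ; mu      = λ X Y X≢Y X≁Y → card-common (CommonCount.card-common-nonadjacent T (value X) (value Y)
                  (point-offSides X) (point-offSides Y) (λ e → X≢Y (value-injective e)) (X≁Y ∘ adjacent⇒pointAdj))
    }

  not-αβ-geometry : ¬ IsAlphaBetaGeometry 𝒟
  not-αβ-geometry (α , β , αβ) =
    let P , P-off = card-suc⇒inhabited card-offSides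
    in not-αβ P P-off α β λ ℓ ℓ-off P∉ℓ →
         map-⊎ (card-collinearOn P P-off ℓ ℓ-off) (card-collinearOn P P-off ℓ ℓ-off)
                      (αβ (refine P (offSides⇒kept P-off)) (refine ℓ ℓ-off) P∉ℓ)
    where
    card-collinearOn : ∀ P (P-off : OffSides P) ℓ (ℓ-off : OffVertices ℓ) {m} →
      HasCard {Point′} (λ Q → value Q I ℓ × Collinear 𝒟 (refine P (offSides⇒kept P-off)) Q) m →
      HasCard (CollinearOn P ℓ) m
    card-collinearOn P P-off ℓ ℓ-off h =
      card-⇔ (λ Q (Q-kept , Qℓ , m , Pm , Qm) → kept⇒offSides Q-kept , Qℓ , value m , line-offVertices m , Pm , Qm)
             (λ Q (Q-off , Qℓ , m , m-off , Pm , Qm) → offSides⇒kept Q-off , Qℓ , refine m m-off , Pm , Qm)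
             (card-unrefine (λ Q → offSides⇒kept (point-offSides Q)) h)

theorem11 : (n : ℕ) → 5 ≤ n → (𝒫 : IncStr) → IsProjectivePlane 𝒫 n →
    (A B C : IncStr.Point 𝒫) → ¬ Collinear₃ 𝒫 A B C →
    IsStronglyRegularConfiguration (deleteTriangle 𝒫 A B C)
      ((n ∸ 1) ^ 2) (n ∸ 2) ((n ∸ 4) ^ 2 + 1) ((n ∸ 3) * (n ∸ 4))
    × ¬ IsAlphaBetaGeometry (deleteTriangle 𝒫 A B C)
theorem11 (suc (suc (suc (suc (suc k))))) (s≤s (s≤s (s≤s (s≤s (s≤s z≤n))))) 𝒫 pp A B C ABC =
  (configuration , strongly-regular) , not-αβ-geometry
  where open DeletedTriangle 𝒫 pp A B C ABC
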